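{- Let $G$ be a graph with $m$ edges and $T$ triangles. Let $\mathcal{A}$ be a sampling algorithm which, when given any graph isomorphic to $G$ as input, samples at least one triangle with constant probability. Then $\mathcal{A}$ must sample $\Omega\!\left(\frac{m}{T^{2/3}}\right)$ edges in expectation.
   Context: Sampling model: a (nonadaptive) sampling algorithm chooses, independently of the input, a distribution over sets $S$ of vertex pairs and receives $E\cap S$ where $E$ is the input edge set; the number of sampled edges is $|E\cap S|$. It samples a triangle if all three of its edges are received.
   Formalization: The sampling algorithm's distribution over sets S of vertex pairs has rational weights, and the constant probability of sampling a triangle is a positive rational. -}

module Defs where

open import Data.Nat as ℕ using (ℕ)
open import Data.Integer using (+_)
open import Data.Fin using (Fin)
open import Data.Fin.Properties using (_<?_)
open import Data.Bool using (Bool; true; false; _∧_; if_then_else_)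
open import Data.List using (allFin; List; []; _∷_; length; filterᵇ; concatMap; foldr)
open import Data.Bool.ListAction using (any)
open import Data.List.Relation.Unary.All using (All)
open import Data.Product using (_×_; _,_; proj₁)


open import Data.Rational as ℚ using (ℚ; 0ℚ; 1ℚ; _/_)
open import Data.Fin.Permutation using (Permutation′; _⟨$⟩ʳ_)
open import Relation.Nullary.Decidable using (⌊_⌋)
open import Relation.Binary.PropositionalEquality using (_≡_)

Adj : ℕ → Set
Adj n = Fin n → Fin n → Bool

record Graph (n : ℕ) : Set where
  field
    adj    : Adj n
    sym    : ∀ i j → adj i j ≡ adj j i
    irrefl : ∀ i → adj i i ≡ false
open Graph public

verts : (n : ℕ) → List (Fin n)
verts n = allFin n

pairs : (n : ℕ) → List (Fin n × Fin n)
pairs n = concatMap (λ i → concatMap (λ j →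
  if ⌊ i <? j ⌋ then (i , j) ∷ [] else []) (verts n)) (verts n)

triples : (n : ℕ) → List (Fin n × Fin n × Fin n)
triples n = concatMap (λ (i , j) → concatMap (λ k →
  if ⌊ j <? k ⌋ then (i , j , k) ∷ [] else []) (verts n)) (pairs n)

count : {A : Set} → (A → Bool) → List A → ℕ
count p xs = length (filterᵇ p xs)

edgeCount : ∀ {n} → Graph n → ℕ
edgeCount {n} G = count (λ (i , j) → adj G i j) (pairs n)

triCount : ∀ {n} → Graph n → ℕ
triCount {n} G =
  count (λ (i , j , k) → adj G i j ∧ adj G j k ∧ adj G i k) (triples n)

permute : ∀ {n} → Permutation′ n → Graph n → Graph n
permute π G = record
  { adj    = λ i j → adj G (π ⟨$⟩ʳ i) (π ⟨$⟩ʳ j)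
  ; sym    = λ i j → sym G (π ⟨$⟩ʳ i) (π ⟨$⟩ʳ j)
  ; irrefl = λ i → irrefl G (π ⟨$⟩ʳ i) }

-- A set S of vertex pairs: the pair {i,j} (i<j) is in S iff S i j ≡ true.
-- (Only entries with i<j are ever consulted.)
PairSet : ℕ → Set
PairSet n = Adj n

sampledEdges : ∀ {n} → Graph n → PairSet n → ℕ
sampledEdges {n} G S = count (λ (i , j) → adj G i j ∧ S i j) (pairs n)

samplesTriangle : ∀ {n} → Graph n → PairSet n → Bool
samplesTriangle {n} G S = any (λ (i , j , k) →
  (adj G i j ∧ adj G j k ∧ adj G i k) ∧ (S i j ∧ S j k ∧ S i k)) (triples n)

toℚ : ℕ → ℚ
toℚ k = (+ k) / 1

-- A nonadaptive sampling algorithm on n-vertex inputs: a finitely supported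
-- probability distribution (rational weights) over sets S of vertex pairs,
-- chosen independently of the input.
record Sampler (n : ℕ) : Set where
  field
    support : List (ℚ × PairSet n)
    nonneg  : All (λ ws → 0ℚ ℚ.≤ proj₁ ws) support
    total   : foldr (λ ws acc → proj₁ ws ℚ.+ acc) 0ℚ support ≡ 1ℚ
open Sampler public

probTriangle : ∀ {n} → Sampler n → Graph n → ℚ
probTriangle A G = foldr (λ (w , S) acc →
  (if samplesTriangle G S then w else 0ℚ) ℚ.+ acc) 0ℚ (support A)

expectedEdges : ∀ {n} → Sampler n → Graph n → ℚ
expectedEdges A G = foldr (λ (w , S) acc →
  w ℚ.* toℚ (sampledEdges G S) ℚ.+ acc) 0ℚ (support A)

{-# OPTIONS --safe #-}
module Submission where

-- By Yao's principle it suffices to average over the n! relabellings π of G for one fixed set S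
-- of s pairs containing t triangles.  A fixed pair of S carries an edge of πG for exactly
-- (n-2)!·2m relabellings, so the sampled edges total s·(n-2)!·2m; a fixed triangle of S is a
-- triangle of πG for (n-3)!·6T relabellings, so S samples a triangle for at most
-- min(n!, t·(n-3)!·6T) of them.  Splitting the vertices of S at degree √s gives t² ≤ 256 s³,
-- so these two totals, hits and load, satisfy (m·hits)³ ≤ 6912 T²·load³.
-- Hence m·hits ≤ κ·load with κ³ = O(T²) for every S; averaging over the sampler's
-- distribution and choosing the relabelling with the most expected edges gives
-- m·p ≤ κ·E, that is E = Ω(m / T^(2/3)).

open import Defs hiding (sym)
open import Algebra.Bundles using (CommutativeSemiring)
open import Data.Nat using (ℕ; zero; suc; _!)
open import Data.Fin using (Fin; zero; suc)
open import Data.Fin.Permutation as Perm using (Permutation′; insert)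
open import Data.List using (List; []; _∷_; foldr)
open import Data.Product using (_×_; _,_)
open import Function using (_∘_)
open import Relation.Binary.Core using (Rel; _Preserves₂_⟶_⟶_)
open import Relation.Binary.Definitions using (Reflexive)
open import Relation.Binary.PropositionalEquality as ≡ using (_≡_; _≗_)

module PermutationSum {c ℓ} (R : CommutativeSemiring c ℓ) where

  open CommutativeSemiring R hiding (zero)
  open import Algebra.Properties.Semiring.Sum semiring public
  open import Algebra.Properties.Monoid.Mult +-monoid using (×-assocˡ) renaming (_×_ to _·_)
  open import Relation.Binary.Reasoning.Setoid setoid
  open import Algebra.Properties.CommutativeSemigroup *-commutativeSemigroup using (x∙yz≈y∙xz)

  -- Sum over the n! permutations of Fin n, each written uniquely as insert zero x σ (sending 0 to x).
  ΣP : ∀ n → (Permutation′ n → Carrier) → Carrier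
  ΣP zero    f = f Perm.id
  ΣP (suc n) f = ∑[ x < suc n ] ΣP n (f ∘ insert zero x)

  ΣP-cong : ∀ n {f g : Permutation′ n → Carrier} → f ≗ g → ΣP n f ≡ ΣP n g
  ΣP-cong zero    f≗g = f≗g Perm.id
  ΣP-cong (suc n) f≗g = sum-cong-≗ (λ x → ΣP-cong n (f≗g ∘ insert zero x))

  ΣP-distrib-+ : ∀ n (f g : Permutation′ n → Carrier) →
                 ΣP n (λ π → f π + g π) ≈ ΣP n f + ΣP n g
  ΣP-distrib-+ zero    f g = refl
  ΣP-distrib-+ (suc n) f g = begin
    ∑[ x < suc n ] ΣP n (λ σ → f (insert zero x σ) + g (insert zero x σ))
      ≈⟨ sum-cong-≋ (λ x → ΣP-distrib-+ n (f ∘ insert zero x) (g ∘ insert zero x)) ⟩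
    ∑[ x < suc n ] (ΣP n (f ∘ insert zero x) + ΣP n (g ∘ insert zero x))
      ≈⟨ ∑-distrib-+ (λ x → ΣP n (f ∘ insert zero x)) (λ x → ΣP n (g ∘ insert zero x)) ⟩
    ΣP (suc n) f + ΣP (suc n) g ∎

  *-distribˡ-ΣP : ∀ n a (f : Permutation′ n → Carrier) →
                  a * ΣP n f ≈ ΣP n (λ π → a * f π)
  *-distribˡ-ΣP zero    a f = refl
  *-distribˡ-ΣP (suc n) a f = begin
    a * ΣP (suc n) f
      ≈⟨ *-distribˡ-sum a (λ x → ΣP n (f ∘ insert zero x)) ⟩
    ∑[ x < suc n ] (a * ΣP n (f ∘ insert zero x))
      ≈⟨ sum-cong-≋ (λ x → *-distribˡ-ΣP n a (f ∘ insert zero x)) ⟩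
    ΣP (suc n) (λ π → a * f π) ∎

  ΣP-comm-∑ : ∀ n {m} (f : Permutation′ n → Fin m → Carrier) →
              ΣP n (λ π → ∑[ i < m ] f π i) ≈ ∑[ i < m ] ΣP n (λ π → f π i)
  ΣP-comm-∑ zero    f = refl
  ΣP-comm-∑ (suc n) f = begin
    ∑[ x < suc n ] ΣP n (λ σ → ∑[ i < _ ] f (insert zero x σ) i)
      ≈⟨ sum-cong-≋ (λ x → ΣP-comm-∑ n (f ∘ insert zero x)) ⟩
    ∑[ x < suc n ] ∑[ i < _ ] ΣP n (λ σ → f (insert zero x σ) i)
      ≈⟨ ∑-comm (λ x i → ΣP n (λ σ → f (insert zero x σ) i)) ⟩
    ∑[ i < _ ] ΣP (suc n) (λ π → f π i) ∎

  ΣP-const : ∀ n a → ΣP n (λ _ → a) ≈ (n !) · a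
  ΣP-const zero    a = sym (+-identityʳ a)
  ΣP-const (suc n) a = begin
    ∑[ x < suc n ] ΣP n (λ _ → a)  ≈⟨ sum-cong-≋ {suc n} (λ _ → ΣP-const n a) ⟩
    ∑[ x < suc n ] ((n !) · a)     ≈⟨ sum-replicate (suc n) ⟩
    suc n · ((n !) · a)           ≈⟨ ×-assocˡ a (suc n) (n !) ⟩
    (suc n !) · a                 ∎

  ΣP-zero : ∀ n → ΣP n (λ _ → 0#) ≈ 0#
  ΣP-zero zero    = refl
  ΣP-zero (suc n) = trans (sum-cong-≋ {suc n} (λ _ → ΣP-zero n)) (sum-replicate-zero (suc n))

  -- The fold of probTriangle and expectedEdges, so that expectedEdges A G is definitionally a weighted sum.
  weighted : {X : Set} → List (Carrier × X) → (X → Carrier) → Carrier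
  weighted xs f = foldr (λ (w , x) acc → w * f x + acc) 0# xs

  weighted-cong : ∀ {X : Set} (xs : List (Carrier × X)) {f g : X → Carrier} → f ≗ g →
                  weighted xs f ≡ weighted xs g
  weighted-cong []             f≗g = ≡.refl
  weighted-cong ((w , x) ∷ xs) f≗g = ≡.cong₂ (λ a b → w * a + b) (f≗g x) (weighted-cong xs f≗g)

  *-distribˡ-weighted : ∀ {X : Set} a (xs : List (Carrier × X)) f →
                        a * weighted xs f ≈ weighted xs (λ x → a * f x)
  *-distribˡ-weighted a []             f = zeroʳ a
  *-distribˡ-weighted a ((w , x) ∷ xs) f = begin
    a * (w * f x + weighted xs f)          ≈⟨ distribˡ a (w * f x) (weighted xs f) ⟩
    a * (w * f x) + a * weighted xs f      ≈⟨ +-cong (x∙yz≈y∙xz a w (f x)) (*-distribˡ-weighted a xs f) ⟩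
    w * (a * f x) + weighted xs (λ x → a * f x) ∎

  ΣP-weighted : ∀ n {X : Set} (xs : List (Carrier × X)) (f : Permutation′ n → X → Carrier) →
                ΣP n (λ π → weighted xs (f π)) ≈ weighted xs (λ x → ΣP n (λ π → f π x))
  ΣP-weighted n []             f = ΣP-zero n
  ΣP-weighted n ((w , x) ∷ xs) f = begin
    ΣP n (λ π → w * f π x + weighted xs (f π))
      ≈⟨ ΣP-distrib-+ n (λ π → w * f π x) (λ π → weighted xs (f π)) ⟩
    ΣP n (λ π → w * f π x) + ΣP n (λ π → weighted xs (f π))
      ≈⟨ +-cong (sym (*-distribˡ-ΣP n w (λ π → f π x))) (ΣP-weighted n xs f) ⟩
    w * ΣP n (λ π → f π x) + weighted xs (λ x → ΣP n (λ π → f π x)) ∎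

  module _ {ℓ′} {_≤_ : Rel Carrier ℓ′} (≤-refl : Reflexive _≤_)
           (+-mono-≤ : _+_ Preserves₂ _≤_ ⟶ _≤_ ⟶ _≤_) where

    ∑-mono : ∀ {n} {f g : Fin n → Carrier} → (∀ i → f i ≤ g i) → sum f ≤ sum g
    ∑-mono {zero}  f≤g = ≤-refl
    ∑-mono {suc n} f≤g = +-mono-≤ (f≤g zero) (∑-mono (f≤g ∘ suc))

    ΣP-mono : ∀ n {f g : Permutation′ n → Carrier} → (∀ π → f π ≤ g π) → ΣP n f ≤ ΣP n g
    ΣP-mono zero    f≤g = f≤g Perm.id
    ΣP-mono (suc n) f≤g = ∑-mono (λ x → ΣP-mono n (f≤g ∘ insert zero x))

module Counting where

  open import Data.Nat as ℕ using (ℕ; zero; suc; _+_; _*_; _^_; _≤_; _<_; _!; z≤n; s≤s; NonZero)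
  import Data.Nat.Properties as ℕ
  open import Data.Nat.Tactic.RingSolver using (solve-∀)
  open import Data.Nat.Solver using (module +-*-Solver)
  open +-*-Solver using (solve; _:+_; _:*_; _:^_; _:=_; con)
  open import Data.Nat.ListAction using () renaming (sum to sumᴸ)
  open import Data.Nat.ListAction.Properties using (sum-++)
  open import Data.Bool using (Bool; true; false; _∧_; not; if_then_else_)
  open import Data.Bool.Properties using (∧-comm; ∧-assoc; ∧-zeroʳ)
  open import Data.Bool.ListAction using (any)
  open import Data.Fin as Fin using (Fin; zero; suc; punchIn)
  open import Data.Fin.Properties using (_<?_; <-cmp; <-asym; <-trans)
  open import Data.Fin.Permutation using (Permutation′; _⟨$⟩ʳ_)
  open import Data.List using (List; []; _∷_; _++_; map; concatMap; allFin; tabulate)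
  open import Data.List.Properties using (map-++)
  open import Data.Product using (_×_; _,_; proj₁; proj₂; ∃-syntax)
  open import Data.Sum using (inj₁; inj₂)
  open import Function using (_∘_; id)
  open import Relation.Binary.Definitions using (tri<; tri≈; tri>)
  open import Relation.Nullary using (yes; no; ¬_; Dec; contradiction)
  open import Relation.Nullary.Decidable using (⌊_⌋)
  open import Relation.Binary.PropositionalEquality
  open import Algebra.Properties.Monoid.Mult ℕ.+-0-monoid using () renaming (_×_ to _·_)

  open PermutationSum ℕ.+-*-commutativeSemiring public hiding (∑-mono; ΣP-mono; ΣP-const)

  ∑-mono-≤ : ∀ {n} {f g : Fin n → ℕ} → (∀ i → f i ℕ.≤ g i) → sum f ℕ.≤ sum g
  ∑-mono-≤ = PermutationSum.∑-mono ℕ.+-*-commutativeSemiring {_≤_ = ℕ._≤_} ℕ.≤-refl ℕ.+-mono-≤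

  ΣP-mono-≤ : ∀ n {f g : Permutation′ n → ℕ} → (∀ π → f π ℕ.≤ g π) → ΣP n f ℕ.≤ ΣP n g
  ΣP-mono-≤ = PermutationSum.ΣP-mono ℕ.+-*-commutativeSemiring {_≤_ = ℕ._≤_} ℕ.≤-refl ℕ.+-mono-≤

  ·≡* : ∀ m n → m · n ≡ m * n
  ·≡* zero    n = refl
  ·≡* (suc m) n = cong (n +_) (·≡* m n)

  ΣP-const : ∀ n a → ΣP n (λ _ → a) ≡ (n !) * a
  ΣP-const n a = trans (PermutationSum.ΣP-const ℕ.+-*-commutativeSemiring n a) (·≡* (n !) a)

  ∑-const : ∀ n a → ∑[ i < n ] a ≡ n * a
  ∑-const n a = trans (sum-replicate n) (·≡* n a)

  ∑∑ : ∀ {n} → (Fin n → Fin n → ℕ) → ℕ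
  ∑∑ h = ∑[ x < _ ] ∑[ y < _ ] h x y

  ∑∑∑ : ∀ {n} → (Fin n → Fin n → Fin n → ℕ) → ℕ
  ∑∑∑ h = ∑[ x < _ ] ∑∑ (h x)

  ∑-removeAt : ∀ {n} (h : Fin (suc n) → ℕ) →
               ∑[ x < suc n ] ∑[ y < n ] h (punchIn x y) ≡ n * sum h
  ∑-removeAt {n} h = ℕ.+-cancelˡ-≡ (sum h) _ _ (begin
    sum h + ∑[ x < suc n ] ∑[ y < n ] h (punchIn x y)
      ≡⟨ ∑-distrib-+ h (λ x → ∑[ y < n ] h (punchIn x y)) ⟨
    ∑[ x < suc n ] (h x + ∑[ y < n ] h (punchIn x y))
      ≡⟨ sum-cong-≗ {suc n} (λ x → sum-remove {i = x} h) ⟨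
    ∑[ x < suc n ] sum h
      ≡⟨ ∑-const (suc n) (sum h) ⟩
    sum h + n * sum h ∎)
    where open ≡-Reasoning

  ∑-removeAt-zero : ∀ {n} (f : Fin (suc n) → ℕ) x → f x ≡ 0 →
                    ∑[ y < n ] f (punchIn x y) ≡ sum f
  ∑-removeAt-zero f x fx≡0 = sym (trans (sum-remove {i = x} f) (cong (_+ sum (f ∘ punchIn x)) fx≡0))

  *-assoc-comm : ∀ a b c → a * (b * c) ≡ (b * a) * c
  *-assoc-comm a b c = trans (sym (ℕ.*-assoc a b c)) (cong (_* c) (ℕ.*-comm a b))

  ΣP-image₁ : ∀ {n} (j : Fin (suc n)) (h : Fin (suc n) → ℕ) →
              ΣP (suc n) (λ π → h (π ⟨$⟩ʳ j)) ≡ (n !) * sum h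
  ΣP-image₁ {n} zero h = begin
    ∑[ x < suc n ] ΣP n (λ _ → h x)   ≡⟨ sum-cong-≗ {suc n} (λ x → ΣP-const n (h x)) ⟩
    ∑[ x < suc n ] ((n !) * h x)      ≡⟨ *-distribˡ-sum (n !) h ⟨
    (n !) * sum h                     ∎
    where open ≡-Reasoning
  ΣP-image₁ {suc n} (suc j) h = begin
    ∑[ x < 2 + n ] ΣP (suc n) (λ σ → h (punchIn x (σ ⟨$⟩ʳ j)))
      ≡⟨ sum-cong-≗ {2 + n} (λ x → ΣP-image₁ j (h ∘ punchIn x)) ⟩
    ∑[ x < 2 + n ] ((n !) * ∑[ y < suc n ] h (punchIn x y))
      ≡⟨ *-distribˡ-sum (n !) (λ x → ∑[ y < suc n ] h (punchIn x y)) ⟨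
    (n !) * ∑[ x < 2 + n ] ∑[ y < suc n ] h (punchIn x y)
      ≡⟨ cong ((n !) *_) (∑-removeAt h) ⟩
    (n !) * (suc n * sum h)
      ≡⟨ *-assoc-comm (n !) (suc n) (sum h) ⟩
    (suc n !) * sum h ∎
    where open ≡-Reasoning

  ∑∑-split : ∀ {n} (h : Fin (suc n) → Fin (suc n) → ℕ) → (∀ z → h z z ≡ 0) → ∀ x →
             ∑∑ h ≡ ∑[ z < suc n ] h z x + (sum (h x) + ∑∑ (λ y y′ → h (punchIn x y) (punchIn x y′)))
  ∑∑-split {n} h h-diag x = begin
    ∑[ z < suc n ] sum (h z)
      ≡⟨ sum-cong-≗ {suc n} (λ z → sum-remove {i = x} (h z)) ⟩
    ∑[ z < suc n ] (h z x + R z)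
      ≡⟨ ∑-distrib-+ (λ z → h z x) R ⟩
    ∑[ z < suc n ] h z x + sum R
      ≡⟨ cong (∑[ z < suc n ] h z x +_) (sum-remove {i = x} R) ⟩
    ∑[ z < suc n ] h z x + (R x + ∑[ y < n ] R (punchIn x y))
      ≡⟨ cong (λ r → ∑[ z < suc n ] h z x + (r + ∑[ y < n ] R (punchIn x y)))
              (∑-removeAt-zero (h x) x (h-diag x)) ⟩
    ∑[ z < suc n ] h z x + (sum (h x) + ∑∑ (λ y y′ → h (punchIn x y) (punchIn x y′))) ∎
    where
    open ≡-Reasoning
    R : Fin (suc n) → ℕ
    R z = ∑[ y′ < n ] h z (punchIn x y′)

  ∑∑-removeAt : ∀ {n} (h : Fin (2 + n) → Fin (2 + n) → ℕ) → (∀ z → h z z ≡ 0) →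
                ∑[ x < 2 + n ] ∑∑ (λ y y′ → h (punchIn x y) (punchIn x y′)) ≡ n * ∑∑ h
  ∑∑-removeAt {n} h h-diag = ℕ.+-cancelˡ-≡ (S + S) (sum I) (n * S) (begin
    S + S + sum I
      ≡⟨ ℕ.+-assoc S S (sum I) ⟩
    S + (S + sum I)
      ≡⟨ cong (_+ (S + sum I)) (∑-comm h) ⟩
    ∑[ x < 2 + n ] C x + (S + sum I)
      ≡⟨ cong (sum C +_) (∑-distrib-+ (sum ∘ h) I) ⟨
    sum C + ∑[ x < 2 + n ] (sum (h x) + I x)
      ≡⟨ ∑-distrib-+ C (λ x → sum (h x) + I x) ⟨
    ∑[ x < 2 + n ] (C x + (sum (h x) + I x))
      ≡⟨ sum-cong-≗ {2 + n} (∑∑-split h h-diag) ⟨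
    ∑[ x < 2 + n ] S
      ≡⟨ ∑-const (2 + n) S ⟩
    S + (S + n * S)
      ≡⟨ ℕ.+-assoc S S (n * S) ⟨
    S + S + n * S ∎)
    where
    open ≡-Reasoning
    S : ℕ
    S = ∑∑ h
    C : Fin (2 + n) → ℕ
    C x = ∑[ z < 2 + n ] h z x
    I : Fin (2 + n) → ℕ
    I x = ∑∑ (λ y y′ → h (punchIn x y) (punchIn x y′))

  ΣP-image₂ : ∀ {n} {i j : Fin (2 + n)} → i Fin.< j → (h : Fin (2 + n) → Fin (2 + n) → ℕ) →
              (∀ z → h z z ≡ 0) →
              ΣP (2 + n) (λ π → h (π ⟨$⟩ʳ i) (π ⟨$⟩ʳ j)) ≡ (n !) * ∑∑ h
  ΣP-image₂ {n} {zero} {suc j} _ h h-diag = begin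
    ∑[ x < 2 + n ] ΣP (suc n) (λ σ → h x (punchIn x (σ ⟨$⟩ʳ j)))
      ≡⟨ sum-cong-≗ {2 + n} (λ x → ΣP-image₁ j (h x ∘ punchIn x)) ⟩
    ∑[ x < 2 + n ] ((n !) * ∑[ y < suc n ] h x (punchIn x y))
      ≡⟨ sum-cong-≗ {2 + n} (λ x → cong ((n !) *_) (∑-removeAt-zero (h x) x (h-diag x))) ⟩
    ∑[ x < 2 + n ] ((n !) * sum (h x))
      ≡⟨ *-distribˡ-sum (n !) (sum ∘ h) ⟨
    (n !) * ∑∑ h ∎
    where open ≡-Reasoning
  ΣP-image₂ {suc n} {suc i} {suc j} (s≤s i<j) h h-diag = begin
    ∑[ x < 3 + n ] ΣP (2 + n) (λ σ → h (punchIn x (σ ⟨$⟩ʳ i)) (punchIn x (σ ⟨$⟩ʳ j)))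
      ≡⟨ sum-cong-≗ {3 + n} (λ x → ΣP-image₂ i<j (λ y y′ → h (punchIn x y) (punchIn x y′))
                                                (h-diag ∘ punchIn x)) ⟩
    ∑[ x < 3 + n ] ((n !) * ∑∑ (λ y y′ → h (punchIn x y) (punchIn x y′)))
      ≡⟨ *-distribˡ-sum (n !) (λ x → ∑∑ (λ y y′ → h (punchIn x y) (punchIn x y′))) ⟨
    (n !) * ∑[ x < 3 + n ] ∑∑ (λ y y′ → h (punchIn x y) (punchIn x y′))
      ≡⟨ cong ((n !) *_) (∑∑-removeAt h h-diag) ⟩
    (n !) * (suc n * ∑∑ h)
      ≡⟨ *-assoc-comm (n !) (suc n) (∑∑ h) ⟩
    (suc n !) * ∑∑ h ∎
    where open ≡-Reasoning
  ΣP-image₂ {zero} {suc zero} {suc zero} (s≤s ())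

  sum-zero : ∀ {n} {f : Fin n → ℕ} → (∀ i → f i ≡ 0) → sum f ≡ 0
  sum-zero {n} f≡0 = trans (sum-cong-≗ {n} f≡0) (sum-replicate-zero n)

  record Diagonal-free {n} (h : Fin n → Fin n → Fin n → ℕ) : Set where
    field
      diag₁₂ : ∀ x z → h x x z ≡ 0
      diag₁₃ : ∀ x z → h x z x ≡ 0
      diag₂₃ : ∀ x z → h z x x ≡ 0
  open Diagonal-free

  ∑∑∑-split : ∀ {n} (h : Fin (suc n) → Fin (suc n) → Fin (suc n) → ℕ) → Diagonal-free h → ∀ x →
              ∑∑∑ h ≡ ∑∑ (h x) + (∑[ z₁ < suc n ] ∑[ z₂ < suc n ] h z₁ z₂ x
                   + (∑[ z₁ < suc n ] ∑[ z₃ < suc n ] h z₁ x z₃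
                   + ∑∑∑ (λ y₁ y₂ y₃ → h (punchIn x y₁) (punchIn x y₂) (punchIn x y₃))))
  ∑∑∑-split {n} h h-diag x = begin
    ∑[ z₁ < suc n ] ∑∑ (h z₁)
      ≡⟨ sum-remove {i = x} (∑∑ ∘ h) ⟩
    ∑∑ (h x) + ∑[ y₁ < n ] ∑∑ (h (punchIn x y₁))
      ≡⟨ cong (∑∑ (h x) +_) (begin
        ∑[ y₁ < n ] ∑∑ (h (punchIn x y₁))
          ≡⟨ sum-cong-≗ {n} (λ y₁ → ∑∑-split (h (punchIn x y₁)) (λ z → diag₂₃ h-diag z (punchIn x y₁)) x) ⟩
        ∑[ y₁ < n ] (Col (punchIn x y₁) + (Row (punchIn x y₁) + Inner y₁))
          ≡⟨ ∑-distrib-+ (Col ∘ punchIn x) (λ y₁ → Row (punchIn x y₁) + Inner y₁) ⟩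
        ∑[ y₁ < n ] Col (punchIn x y₁) + ∑[ y₁ < n ] (Row (punchIn x y₁) + Inner y₁)
          ≡⟨ cong (∑[ y₁ < n ] Col (punchIn x y₁) +_) (∑-distrib-+ (Row ∘ punchIn x) Inner) ⟩
        ∑[ y₁ < n ] Col (punchIn x y₁) + (∑[ y₁ < n ] Row (punchIn x y₁) + sum Inner)
          ≡⟨ cong₂ (λ c r → c + (r + sum Inner))
               (∑-removeAt-zero Col x (sum-zero (diag₁₃ h-diag x)))
               (∑-removeAt-zero Row x (sum-zero (diag₁₂ h-diag x))) ⟩
        sum Col + (sum Row + sum Inner) ∎) ⟩
    ∑∑ (h x) + (sum Col + (sum Row + sum Inner)) ∎
    where
    open ≡-Reasoning
    Col Row : Fin (suc n) → ℕ
    Col z₁ = ∑[ z₂ < suc n ] h z₁ z₂ x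
    Row z₁ = ∑[ z₃ < suc n ] h z₁ x z₃
    Inner : Fin n → ℕ
    Inner y₁ = ∑∑ (λ y₂ y₃ → h (punchIn x y₁) (punchIn x y₂) (punchIn x y₃))

  ∑∑∑-removeAt : ∀ {n} (h : Fin (3 + n) → Fin (3 + n) → Fin (3 + n) → ℕ) → Diagonal-free h →
                 ∑[ x < 3 + n ] ∑∑∑ (λ y₁ y₂ y₃ → h (punchIn x y₁) (punchIn x y₂) (punchIn x y₃))
                   ≡ n * ∑∑∑ h
  ∑∑∑-removeAt {n} h h-diag =
    ℕ.+-cancelˡ-≡ S _ _ (ℕ.+-cancelˡ-≡ S _ _ (ℕ.+-cancelˡ-≡ S _ _ (begin
      S + (S + (S + sum I))
        ≡⟨ cong₂ (λ c b → S + (c + (b + sum I))) sum-Col sum-Row ⟨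
      sum (∑∑ ∘ h) + (sum Col + (sum Row + sum I))
        ≡⟨ cong (λ t → sum (∑∑ ∘ h) + (sum Col + t)) (∑-distrib-+ Row I) ⟨
      sum (∑∑ ∘ h) + (sum Col + ∑[ x < 3 + n ] (Row x + I x))
        ≡⟨ cong (sum (∑∑ ∘ h) +_) (∑-distrib-+ Col (λ x → Row x + I x)) ⟨
      sum (∑∑ ∘ h) + ∑[ x < 3 + n ] (Col x + (Row x + I x))
        ≡⟨ ∑-distrib-+ (∑∑ ∘ h) (λ x → Col x + (Row x + I x)) ⟨
      ∑[ x < 3 + n ] (∑∑ (h x) + (Col x + (Row x + I x)))
        ≡⟨ sum-cong-≗ {3 + n} (∑∑∑-split h h-diag) ⟨
      ∑[ x < 3 + n ] S
        ≡⟨ ∑-const (3 + n) S ⟩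
      S + (S + (S + n * S)) ∎)))
    where
    open ≡-Reasoning
    S : ℕ
    S = ∑∑∑ h
    Col Row I : Fin (3 + n) → ℕ
    Col x = ∑[ z₁ < 3 + n ] ∑[ z₂ < 3 + n ] h z₁ z₂ x
    Row x = ∑[ z₁ < 3 + n ] ∑[ z₃ < 3 + n ] h z₁ x z₃
    I x = ∑∑∑ (λ y₁ y₂ y₃ → h (punchIn x y₁) (punchIn x y₂) (punchIn x y₃))
    sum-Col : sum Col ≡ S
    sum-Col = trans (∑-comm (λ x z₁ → ∑[ z₂ < 3 + n ] h z₁ z₂ x))
                    (sum-cong-≗ {3 + n} (λ z₁ → ∑-comm (λ x z₂ → h z₁ z₂ x)))
    sum-Row : sum Row ≡ S
    sum-Row = ∑-comm (λ x z₁ → ∑[ z₃ < 3 + n ] h z₁ x z₃)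

  ∑∑-removeAt-slice : ∀ {n} (h : Fin (suc n) → Fin (suc n) → Fin (suc n) → ℕ) → Diagonal-free h →
                     ∀ x → ∑∑ (λ y y′ → h x (punchIn x y) (punchIn x y′)) ≡ ∑∑ (h x)
  ∑∑-removeAt-slice {n} h h-diag x = sym (begin
    ∑∑ (h x)
      ≡⟨ ∑∑-split (h x) (λ z → diag₂₃ h-diag z x) x ⟩
    ∑[ z < suc n ] h x z x + (sum (h x x) + ∑∑ (λ y y′ → h x (punchIn x y) (punchIn x y′)))
      ≡⟨ cong₂ (λ c r → c + (r + ∑∑ (λ y y′ → h x (punchIn x y) (punchIn x y′))))
               (sum-zero (diag₁₃ h-diag x)) (sum-zero (diag₁₂ h-diag x)) ⟩
    ∑∑ (λ y y′ → h x (punchIn x y) (punchIn x y′)) ∎)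
    where open ≡-Reasoning

  ΣP-image₃ : ∀ {n} {i j k : Fin (3 + n)} → i Fin.< j → j Fin.< k →
              (h : Fin (3 + n) → Fin (3 + n) → Fin (3 + n) → ℕ) → Diagonal-free h →
              ΣP (3 + n) (λ π → h (π ⟨$⟩ʳ i) (π ⟨$⟩ʳ j) (π ⟨$⟩ʳ k)) ≡ (n !) * ∑∑∑ h
  ΣP-image₃ {n} {zero} {suc j} {suc k} _ (s≤s j<k) h h-diag = begin
    ∑[ x < 3 + n ] ΣP (2 + n) (λ σ → h x (punchIn x (σ ⟨$⟩ʳ j)) (punchIn x (σ ⟨$⟩ʳ k)))
      ≡⟨ sum-cong-≗ {3 + n} (λ x → ΣP-image₂ j<k (λ y y′ → h x (punchIn x y) (punchIn x y′))
                                                (λ y → diag₂₃ h-diag (punchIn x y) x)) ⟩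
    ∑[ x < 3 + n ] ((n !) * ∑∑ (λ y y′ → h x (punchIn x y) (punchIn x y′)))
      ≡⟨ sum-cong-≗ {3 + n} (λ x → cong ((n !) *_) (∑∑-removeAt-slice h h-diag x)) ⟩
    ∑[ x < 3 + n ] ((n !) * ∑∑ (h x))
      ≡⟨ *-distribˡ-sum (n !) (∑∑ ∘ h) ⟨
    (n !) * ∑∑∑ h ∎
    where open ≡-Reasoning
  ΣP-image₃ {suc n} {suc i} {suc j} {suc k} (s≤s i<j) (s≤s j<k) h h-diag = begin
    ∑[ x < 4 + n ] ΣP (3 + n) (λ σ → h (punchIn x (σ ⟨$⟩ʳ i)) (punchIn x (σ ⟨$⟩ʳ j)) (punchIn x (σ ⟨$⟩ʳ k)))
      ≡⟨ sum-cong-≗ {4 + n} (λ x → ΣP-image₃ i<j j<k (h′ x) (h′-diag x)) ⟩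
    ∑[ x < 4 + n ] ((n !) * ∑∑∑ (h′ x))
      ≡⟨ *-distribˡ-sum (n !) (∑∑∑ ∘ h′) ⟨
    (n !) * ∑[ x < 4 + n ] ∑∑∑ (h′ x)
      ≡⟨ cong ((n !) *_) (∑∑∑-removeAt h h-diag) ⟩
    (n !) * (suc n * ∑∑∑ h)
      ≡⟨ *-assoc-comm (n !) (suc n) (∑∑∑ h) ⟩
    (suc n !) * ∑∑∑ h ∎
    where
    open ≡-Reasoning
    h′ : Fin (4 + n) → Fin (3 + n) → Fin (3 + n) → Fin (3 + n) → ℕ
    h′ x y₁ y₂ y₃ = h (punchIn x y₁) (punchIn x y₂) (punchIn x y₃)
    h′-diag : ∀ x → Diagonal-free (h′ x)
    h′-diag x = record
      { diag₁₂ = λ y z → diag₁₂ h-diag (punchIn x y) (punchIn x z)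
      ; diag₁₃ = λ y z → diag₁₃ h-diag (punchIn x y) (punchIn x z)
      ; diag₂₃ = λ y z → diag₂₃ h-diag (punchIn x y) (punchIn x z)
      }
  ΣP-image₃ {zero} {suc i} {suc zero} {_} (s≤s ()) _
  ΣP-image₃ {zero} {suc zero} {suc (suc zero)} {suc (suc zero)} _ (s≤s (s≤s ()))

  𝟙 : Bool → ℕ
  𝟙 true  = 1
  𝟙 false = 0

  𝟙-∧ : ∀ a b → 𝟙 (a ∧ b) ≡ 𝟙 a * 𝟙 b
  𝟙-∧ true  b = sym (ℕ.+-identityʳ (𝟙 b))
  𝟙-∧ false b = refl

  𝟙≤1 : ∀ b → 𝟙 b ≤ 1
  𝟙≤1 true  = s≤s z≤n
  𝟙≤1 false = z≤n

  𝟙[_<_] : ∀ {n} → Fin n → Fin n → ℕ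
  𝟙[ i < j ] = 𝟙 ⌊ i <? j ⌋

  module _ {A : Set} where

    count≡sum : (p : A → Bool) (xs : List A) → count p xs ≡ sumᴸ (map (𝟙 ∘ p) xs)
    count≡sum p []       = refl
    count≡sum p (x ∷ xs) with p x
    ... | true  = cong suc (count≡sum p xs)
    ... | false = count≡sum p xs

    𝟙-any≤count : (p : A → Bool) (xs : List A) → 𝟙 (any p xs) ≤ count p xs
    𝟙-any≤count p []       = z≤n
    𝟙-any≤count p (x ∷ xs) with p x
    ... | true  = s≤s z≤n
    ... | false = 𝟙-any≤count p xs

    sum-map-if : (g : A → ℕ) (b : Bool) (a : A) → sumᴸ (map g (if b then a ∷ [] else [])) ≡ 𝟙 b * g a
    sum-map-if g true  a = refl
    sum-map-if g false a = refl

    sum-map-concatMap : ∀ {B : Set} (g : B → ℕ) (f : A → List B) xs →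
      sumᴸ (map g (concatMap f xs)) ≡ sumᴸ (map (λ x → sumᴸ (map g (f x))) xs)
    sum-map-concatMap g f []       = refl
    sum-map-concatMap g f (x ∷ xs) = begin
      sumᴸ (map g (f x ++ concatMap f xs))
        ≡⟨ cong sumᴸ (map-++ g (f x) (concatMap f xs)) ⟩
      sumᴸ (map g (f x) ++ map g (concatMap f xs))
        ≡⟨ sum-++ (map g (f x)) _ ⟩
      sumᴸ (map g (f x)) + sumᴸ (map g (concatMap f xs))
        ≡⟨ cong (sumᴸ (map g (f x)) +_) (sum-map-concatMap g f xs) ⟩
      sumᴸ (map g (f x)) + sumᴸ (map (λ x → sumᴸ (map g (f x))) xs) ∎
      where open ≡-Reasoning

  sum-map-tabulate : ∀ {A : Set} {n} (g : A → ℕ) (f : Fin n → A) →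
                     sumᴸ (map g (tabulate f)) ≡ ∑[ i < n ] g (f i)
  sum-map-tabulate {n = zero}  g f = refl
  sum-map-tabulate {n = suc n} g f = cong (g (f Fin.zero) +_) (sum-map-tabulate g (f ∘ Fin.suc))

  sum-map-allFin : ∀ {n} (g : Fin n → ℕ) → sumᴸ (map g (allFin n)) ≡ sum g
  sum-map-allFin g = sum-map-tabulate g id

  sum-pairs : ∀ n (g : Fin n × Fin n → ℕ) →
              sumᴸ (map g (pairs n)) ≡ ∑[ i < n ] ∑[ j < n ] (𝟙[ i < j ] * g (i , j))
  sum-pairs n g = begin
    sumᴸ (map g (concatMap row (allFin n)))
      ≡⟨ sum-map-concatMap g row (allFin n) ⟩
    sumᴸ (map (λ i → sumᴸ (map g (row i))) (allFin n))
      ≡⟨ sum-map-allFin (λ i → sumᴸ (map g (row i))) ⟩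
    ∑[ i < n ] sumᴸ (map g (row i))
      ≡⟨ sum-cong-≗ {n} sum-row ⟩
    ∑[ i < n ] ∑[ j < n ] (𝟙[ i < j ] * g (i , j)) ∎
    where
    open ≡-Reasoning
    row : Fin n → List (Fin n × Fin n)
    row i = concatMap (λ j → if ⌊ i <? j ⌋ then (i , j) ∷ [] else []) (allFin n)
    sum-row : ∀ i → sumᴸ (map g (row i)) ≡ ∑[ j < n ] (𝟙[ i < j ] * g (i , j))
    sum-row i = begin
      sumᴸ (map g (row i))
        ≡⟨ sum-map-concatMap g _ (allFin n) ⟩
      sumᴸ (map (λ j → sumᴸ (map g (if ⌊ i <? j ⌋ then (i , j) ∷ [] else []))) (allFin n))
        ≡⟨ sum-map-allFin {n} _ ⟩
      ∑[ j < n ] sumᴸ (map g (if ⌊ i <? j ⌋ then (i , j) ∷ [] else []))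
        ≡⟨ sum-cong-≗ {n} (λ j → sum-map-if g ⌊ i <? j ⌋ (i , j)) ⟩
      ∑[ j < n ] (𝟙[ i < j ] * g (i , j)) ∎

  sum-triples : ∀ n (g : Fin n × Fin n × Fin n → ℕ) →
                sumᴸ (map g (triples n))
                  ≡ ∑[ i < n ] ∑[ j < n ] (𝟙[ i < j ] * ∑[ k < n ] (𝟙[ j < k ] * g (i , j , k)))
  sum-triples n g = begin
    sumᴸ (map g (concatMap extend (pairs n)))
      ≡⟨ sum-map-concatMap g extend (pairs n) ⟩
    sumᴸ (map (λ ij → sumᴸ (map g (extend ij))) (pairs n))
      ≡⟨ sum-pairs n (λ ij → sumᴸ (map g (extend ij))) ⟩
    ∑[ i < n ] ∑[ j < n ] (𝟙[ i < j ] * sumᴸ (map g (extend (i , j))))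
      ≡⟨ sum-cong-≗ {n} (λ i → sum-cong-≗ {n} (λ j → cong (𝟙[ i < j ] *_) (sum-extend i j))) ⟩
    ∑[ i < n ] ∑[ j < n ] (𝟙[ i < j ] * ∑[ k < n ] (𝟙[ j < k ] * g (i , j , k))) ∎
    where
    open ≡-Reasoning
    extend : Fin n × Fin n → List (Fin n × Fin n × Fin n)
    extend (i , j) = concatMap (λ k → if ⌊ j <? k ⌋ then (i , j , k) ∷ [] else []) (allFin n)
    sum-extend : ∀ i j → sumᴸ (map g (extend (i , j))) ≡ ∑[ k < n ] (𝟙[ j < k ] * g (i , j , k))
    sum-extend i j = begin
      sumᴸ (map g (extend (i , j)))
        ≡⟨ sum-map-concatMap g _ (allFin n) ⟩
      sumᴸ (map (λ k → sumᴸ (map g (if ⌊ j <? k ⌋ then (i , j , k) ∷ [] else []))) (allFin n))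
        ≡⟨ sum-map-allFin {n} _ ⟩
      ∑[ k < n ] sumᴸ (map g (if ⌊ j <? k ⌋ then (i , j , k) ∷ [] else []))
        ≡⟨ sum-cong-≗ {n} (λ k → sum-map-if g ⌊ j <? k ⌋ (i , j , k)) ⟩
      ∑[ k < n ] (𝟙[ j < k ] * g (i , j , k)) ∎

  𝟙[<]-yes : ∀ {n} {i j : Fin n} → i Fin.< j → 𝟙[ i < j ] ≡ 1
  𝟙[<]-yes {i = i} {j} i<j with i <? j
  ... | yes _   = refl
  ... | no i≮j = contradiction i<j i≮j

  𝟙[<]-no : ∀ {n} {i j : Fin n} → ¬ i Fin.< j → 𝟙[ i < j ] ≡ 0
  𝟙[<]-no {i = i} {j} i≮j with i <? j
  ... | yes i<j = contradiction i<j i≮j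
  ... | no _    = refl

  ∑∑-distrib-+ : ∀ {n} (f g : Fin n → Fin n → ℕ) →
                 ∑∑ (λ x y → f x y + g x y) ≡ ∑∑ f + ∑∑ g
  ∑∑-distrib-+ {n} f g = trans (sum-cong-≗ {n} (λ x → ∑-distrib-+ (f x) (g x)))
                               (∑-distrib-+ (sum ∘ f) (sum ∘ g))

  ∑∑∑-distrib-+ : ∀ {n} (f g : Fin n → Fin n → Fin n → ℕ) →
                  ∑∑∑ (λ x y z → f x y z + g x y z) ≡ ∑∑∑ f + ∑∑∑ g
  ∑∑∑-distrib-+ {n} f g = trans (sum-cong-≗ {n} (λ x → ∑∑-distrib-+ (f x) (g x)))
                                (∑-distrib-+ (∑∑ ∘ f) (∑∑ ∘ g))

  ∑∑∑-mono-≤ : ∀ {n} {f g : Fin n → Fin n → Fin n → ℕ} →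
               (∀ x y z → f x y z ≤ g x y z) → ∑∑∑ f ≤ ∑∑∑ g
  ∑∑∑-mono-≤ f≤g = ∑-mono-≤ (λ x → ∑-mono-≤ (λ y → ∑-mono-≤ (f≤g x y)))

  split-by-order : ∀ {n} (f : Fin n → Fin n → ℕ) → (∀ x → f x x ≡ 0) →
                   ∀ x y → f x y ≡ 𝟙[ x < y ] * f x y + 𝟙[ y < x ] * f x y
  split-by-order f f-diag x y with <-cmp x y
  ... | tri< x<y _ _ rewrite 𝟙[<]-yes x<y | 𝟙[<]-no (<-asym x<y) =
    sym (trans (ℕ.+-identityʳ _) (ℕ.+-identityʳ _))
  ... | tri≈ _ refl _ rewrite f-diag x =
    sym (cong₂ _+_ (ℕ.*-zeroʳ 𝟙[ x < x ]) (ℕ.*-zeroʳ 𝟙[ x < x ]))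
  ... | tri> _ _ y<x rewrite 𝟙[<]-yes y<x | 𝟙[<]-no (<-asym y<x) = sym (ℕ.+-identityʳ _)

  ∑∑-symmetric : ∀ {n} (f : Fin n → Fin n → ℕ) → (∀ x y → f x y ≡ f y x) → (∀ x → f x x ≡ 0) →
                 ∑∑ f ≡ 2 * ∑∑ (λ x y → 𝟙[ x < y ] * f x y)
  ∑∑-symmetric {n} f f-sym f-diag = begin
    ∑∑ f
      ≡⟨ sum-cong-≗ {n} (λ x → sum-cong-≗ {n} (split-by-order f f-diag x)) ⟩
    ∑∑ (λ x y → 𝟙[ x < y ] * f x y + 𝟙[ y < x ] * f x y)
      ≡⟨ ∑∑-distrib-+ (λ x y → 𝟙[ x < y ] * f x y) (λ x y → 𝟙[ y < x ] * f x y) ⟩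
    S + ∑∑ (λ x y → 𝟙[ y < x ] * f x y)
      ≡⟨ cong (S +_) (∑-comm (λ x y → 𝟙[ y < x ] * f x y)) ⟩
    S + ∑∑ (λ y x → 𝟙[ y < x ] * f x y)
      ≡⟨ cong (S +_) (sum-cong-≗ {n} (λ y → sum-cong-≗ {n} (λ x → cong (𝟙[ y < x ] *_) (f-sym x y)))) ⟩
    S + S
      ≡⟨ cong (S +_) (ℕ.+-identityʳ S) ⟨
    2 * S ∎
    where
    open ≡-Reasoning
    S : ℕ
    S = ∑∑ (λ x y → 𝟙[ x < y ] * f x y)

  record Symmetric₃ {n} (t : Fin n → Fin n → Fin n → ℕ) : Set where
    field
      sym₁₂ : ∀ x y z → t x y z ≡ t y x z
      sym₂₃ : ∀ x y z → t x y z ≡ t x z y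
  open Symmetric₃

  sorted : ∀ {n} → (Fin n → Fin n → Fin n → ℕ) → Fin n → Fin n → Fin n → ℕ
  sorted t x y z = 𝟙[ x < y ] * (𝟙[ y < z ] * t x y z)

  sorted-yes : ∀ {n} (t : Fin n → Fin n → Fin n → ℕ) {i j k} → i Fin.< j → j Fin.< k → sorted t i j k ≡ t i j k
  sorted-yes t {i} {j} {k} i<j j<k rewrite 𝟙[<]-yes i<j | 𝟙[<]-yes j<k =
    trans (ℕ.+-identityʳ _) (ℕ.+-identityʳ (t i j k))

  sorted-no₁ : ∀ {n} (t : Fin n → Fin n → Fin n → ℕ) {i j} k → ¬ i Fin.< j → sorted t i j k ≡ 0
  sorted-no₁ t k i≮j rewrite 𝟙[<]-no i≮j = refl

  sorted-no₂ : ∀ {n} (t : Fin n → Fin n → Fin n → ℕ) i {j k} → ¬ j Fin.< k → sorted t i j k ≡ 0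
  sorted-no₂ t i {j} {k} j≮k rewrite 𝟙[<]-no j≮k = ℕ.*-zeroʳ 𝟙[ i < j ]

  -- Inserting x into the sorted pair y < z: x lands below y, between y and z, or above z.
  insertion-cover : ∀ {n} {x y z : Fin n} → x ≢ y → x ≢ z →
                    𝟙[ y < z ] ≤ 𝟙[ x < y ] * 𝟙[ y < z ] + 𝟙[ y < x ] * 𝟙[ x < z ] + 𝟙[ y < z ] * 𝟙[ z < x ]
  insertion-cover {x = x} {y} {z} x≢y x≢z with <-cmp y z
  ... | tri≈ y≮z _ _ rewrite 𝟙[<]-no y≮z = z≤n
  ... | tri> y≮z _ _ rewrite 𝟙[<]-no y≮z = z≤n
  ... | tri< y<z _ _ rewrite 𝟙[<]-yes y<z with <-cmp x y
  ...   | tri< x<y _ _ rewrite 𝟙[<]-yes x<y = s≤s z≤n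
  ...   | tri≈ _ x≡y _ = contradiction x≡y x≢y
  ...   | tri> x≮y _ y<x rewrite 𝟙[<]-no x≮y | 𝟙[<]-yes y<x with <-cmp x z
  ...     | tri< x<z _ _ rewrite 𝟙[<]-yes x<z = s≤s z≤n
  ...     | tri≈ _ x≡z _ = contradiction x≡z x≢z
  ...     | tri> x≮z _ z<x rewrite 𝟙[<]-no x≮z | 𝟙[<]-yes z<x = s≤s z≤n

  insert-third : ∀ {n} (t : Fin n → Fin n → Fin n → ℕ) → Symmetric₃ t → Diagonal-free t → ∀ x y z →
                 𝟙[ y < z ] * t x y z ≤ sorted t x y z + sorted t y x z + sorted t y z x
  insert-third t t-sym t-diag x y z with x Fin.≟ y | x Fin.≟ z
  ... | yes refl | _ rewrite diag₁₂ t-diag x z | ℕ.*-zeroʳ 𝟙[ x < z ] = z≤n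
  ... | no _ | yes refl rewrite diag₁₃ t-diag x y | ℕ.*-zeroʳ 𝟙[ y < x ] = z≤n
  ... | no x≢y | no x≢z = begin
    𝟙[ y < z ] * t x y z
      ≤⟨ ℕ.*-monoˡ-≤ (t x y z) (insertion-cover x≢y x≢z) ⟩
    (𝟙[ x < y ] * 𝟙[ y < z ] + 𝟙[ y < x ] * 𝟙[ x < z ] + 𝟙[ y < z ] * 𝟙[ z < x ]) * t x y z
      ≡⟨ distribute 𝟙[ x < y ] 𝟙[ y < z ] 𝟙[ y < x ] 𝟙[ x < z ] 𝟙[ z < x ] (t x y z) ⟩
    sorted t x y z + 𝟙[ y < x ] * (𝟙[ x < z ] * t x y z) + 𝟙[ y < z ] * (𝟙[ z < x ] * t x y z)
      ≡⟨ cong₂ (λ u v → sorted t x y z + 𝟙[ y < x ] * (𝟙[ x < z ] * u) + 𝟙[ y < z ] * (𝟙[ z < x ] * v))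
               (sym₁₂ t-sym x y z) (trans (sym₁₂ t-sym x y z) (sym₂₃ t-sym y x z)) ⟩
    sorted t x y z + sorted t y x z + sorted t y z x ∎
    where
    open ℕ.≤-Reasoning
    distribute : ∀ a b c d e s → (a * b + c * d + b * e) * s ≡ a * (b * s) + c * (d * s) + b * (e * s)
    distribute = solve-∀

  ∑∑∑-symmetric-≤ : ∀ {n} (t : Fin n → Fin n → Fin n → ℕ) → Symmetric₃ t → Diagonal-free t →
                    ∑∑∑ t ≤ 6 * ∑∑∑ (sorted t)
  ∑∑∑-symmetric-≤ {n} t t-sym t-diag = begin
    ∑[ x < n ] ∑∑ (t x)
      ≡⟨ sum-cong-≗ {n} (λ x → ∑∑-symmetric (t x) (sym₂₃ t-sym x) (λ y → diag₂₃ t-diag y x)) ⟩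
    ∑[ x < n ] (2 * ∑∑ (λ y z → 𝟙[ y < z ] * t x y z))
      ≡⟨ *-distribˡ-sum 2 (λ x → ∑∑ (λ y z → 𝟙[ y < z ] * t x y z)) ⟨
    2 * ∑∑∑ (λ x y z → 𝟙[ y < z ] * t x y z)
      ≤⟨ ℕ.*-monoʳ-≤ 2 (∑∑∑-mono-≤ (insert-third t t-sym t-diag)) ⟩
    2 * ∑∑∑ (λ x y z → sorted t x y z + sorted t y x z + sorted t y z x)
      ≡⟨ cong (2 *_) (trans (∑∑∑-distrib-+ (λ x y z → sorted t x y z + sorted t y x z) (λ x y z → sorted t y z x))
                            (cong (_+ ∑∑∑ (λ x y z → sorted t y z x))
                                  (∑∑∑-distrib-+ (sorted t) (λ x y z → sorted t y x z)))) ⟩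
    2 * (S + ∑∑∑ (λ x y z → sorted t y x z) + ∑∑∑ (λ x y z → sorted t y z x))
      ≡⟨ cong₂ (λ u v → 2 * (S + u + v)) swap₁₂ rotate ⟩
    2 * (S + S + S)
      ≡⟨ six S ⟩
    6 * S ∎
    where
    open ℕ.≤-Reasoning
    six : ∀ s → 2 * (s + s + s) ≡ 6 * s
    six = solve-∀
    S : ℕ
    S = ∑∑∑ (sorted t)
    swap₁₂ : ∑∑∑ (λ x y z → sorted t y x z) ≡ S
    swap₁₂ = ∑-comm (λ x y → ∑[ z < n ] sorted t y x z)
    rotate : ∑∑∑ (λ x y z → sorted t y z x) ≡ S
    rotate = trans (∑-comm (λ x y → ∑[ z < n ] sorted t y z x))
                   (sum-cong-≗ {n} (λ y → ∑-comm (λ x z → sorted t y z x)))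

  count-pairs : ∀ n (p : Fin n × Fin n → Bool) →
                count p (pairs n) ≡ ∑∑ (λ i j → 𝟙[ i < j ] * 𝟙 (p (i , j)))
  count-pairs n p = trans (count≡sum p (pairs n)) (sum-pairs n (𝟙 ∘ p))

  count-triples : ∀ n (p : Fin n × Fin n × Fin n → Bool) →
                  count p (triples n) ≡ ∑∑∑ (sorted (λ i j k → 𝟙 (p (i , j , k))))
  count-triples n p = begin
    count p (triples n)
      ≡⟨ count≡sum p (triples n) ⟩
    sumᴸ (map (𝟙 ∘ p) (triples n))
      ≡⟨ sum-triples n (𝟙 ∘ p) ⟩
    ∑[ i < n ] ∑[ j < n ] (𝟙[ i < j ] * ∑[ k < n ] (𝟙[ j < k ] * 𝟙 (p (i , j , k))))
      ≡⟨ sum-cong-≗ {n} (λ i → sum-cong-≗ {n} (λ j →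
           *-distribˡ-sum 𝟙[ i < j ] (λ k → 𝟙[ j < k ] * 𝟙 (p (i , j , k))))) ⟩
    ∑∑∑ (sorted (λ i j k → 𝟙 (p (i , j , k)))) ∎
    where open ≡-Reasoning

  module _ {n} (R : Adj n) where

    edge : Fin n → Fin n → ℕ
    edge x y = 𝟙 (R x y)

    triangle : Fin n → Fin n → Fin n → ℕ
    triangle x y z = 𝟙 (R x y ∧ R y z ∧ R x z)

  module _ {n} (G : Graph n) where

    edgeCount≡ : edgeCount G ≡ ∑∑ (λ i j → 𝟙[ i < j ] * edge (adj G) i j)
    edgeCount≡ = count-pairs n _

    triCount≡ : triCount G ≡ ∑∑∑ (sorted (triangle (adj G)))
    triCount≡ = count-triples n _

    ∑∑-edge : ∑∑ (edge (adj G)) ≡ 2 * edgeCount G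
    ∑∑-edge = trans (∑∑-symmetric (edge (adj G)) (λ x y → cong 𝟙 (Graph.sym G x y)) (λ x → cong 𝟙 (irrefl G x)))
                    (cong (2 *_) (sym edgeCount≡))

    triangle-symmetric : Symmetric₃ (triangle (adj G))
    triangle-symmetric = record
      { sym₁₂ = λ x y z → cong 𝟙 (begin
          adj G x y ∧ adj G y z ∧ adj G x z ≡⟨ cong (_∧ (adj G y z ∧ adj G x z)) (Graph.sym G x y) ⟩
          adj G y x ∧ adj G y z ∧ adj G x z ≡⟨ cong (adj G y x ∧_) (∧-comm (adj G y z) (adj G x z)) ⟩
          adj G y x ∧ adj G x z ∧ adj G y z ∎)
      ; sym₂₃ = λ x y z → cong 𝟙 (begin
          adj G x y ∧ adj G y z ∧ adj G x z   ≡⟨ ∧-comm (adj G x y) _ ⟩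
          (adj G y z ∧ adj G x z) ∧ adj G x y ≡⟨ cong (_∧ adj G x y) (∧-comm (adj G y z) (adj G x z)) ⟩
          (adj G x z ∧ adj G y z) ∧ adj G x y ≡⟨ ∧-assoc (adj G x z) (adj G y z) (adj G x y) ⟩
          adj G x z ∧ adj G y z ∧ adj G x y   ≡⟨ cong (λ b → adj G x z ∧ b ∧ adj G x y) (Graph.sym G y z) ⟩
          adj G x z ∧ adj G z y ∧ adj G x y   ∎)
      }
      where open ≡-Reasoning

    triangle-diagonal-free : Diagonal-free (triangle (adj G))
    triangle-diagonal-free = record
      { diag₁₂ = λ x z → cong (λ b → 𝟙 (b ∧ adj G x z ∧ adj G x z)) (irrefl G x)
      ; diag₁₃ = λ x z → trans (cong (λ b → 𝟙 (adj G x z ∧ adj G z x ∧ b)) (irrefl G x))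
                               (cong 𝟙 (trans (cong (adj G x z ∧_) (∧-zeroʳ (adj G z x)))
                                              (∧-zeroʳ (adj G x z))))
      ; diag₂₃ = λ x z → trans (cong (λ b → 𝟙 (adj G z x ∧ b ∧ adj G z x)) (irrefl G x))
                               (cong 𝟙 (∧-zeroʳ (adj G z x)))
      }

    ∑∑∑-triangle : ∑∑∑ (triangle (adj G)) ≤ 6 * triCount G
    ∑∑∑-triangle = ℕ.≤-trans (∑∑∑-symmetric-≤ (triangle (adj G)) triangle-symmetric triangle-diagonal-free)
                             (ℕ.≤-reflexive (cong (6 *_) (sym triCount≡)))

  𝟙-∧-comm : ∀ a b → 𝟙 (a ∧ b) ≡ 𝟙 b * 𝟙 a
  𝟙-∧-comm a b = trans (𝟙-∧ a b) (ℕ.*-comm (𝟙 a) (𝟙 b))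

  𝟙[<]-guard : ∀ {n} (i j : Fin n) {x y : ℕ} → (i Fin.< j → x ≡ y) → 𝟙[ i < j ] * x ≡ 𝟙[ i < j ] * y
  𝟙[<]-guard i j x≡y with i <? j
  ... | yes i<j = cong (1 *_) (x≡y i<j)
  ... | no _    = refl

  ΣP-∑∑ : ∀ n {m} (f : Permutation′ n → Fin m → Fin m → ℕ) →
          ΣP n (λ π → ∑∑ (f π)) ≡ ∑∑ (λ i j → ΣP n (λ π → f π i j))
  ΣP-∑∑ n {m} f = trans (ΣP-comm-∑ n (λ π i → sum (f π i)))
                        (sum-cong-≗ {m} (λ i → ΣP-comm-∑ n (λ π → f π i)))

  ΣP-∑∑∑ : ∀ n {m} (f : Permutation′ n → Fin m → Fin m → Fin m → ℕ) →
           ΣP n (λ π → ∑∑∑ (f π)) ≡ ∑∑∑ (λ i j k → ΣP n (λ π → f π i j k))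
  ΣP-∑∑∑ n {m} f = trans (ΣP-comm-∑ n (λ π i → ∑∑ (f π i)))
                         (sum-cong-≗ {m} (λ i → ΣP-∑∑ n (λ π → f π i)))

  ∑∑-*ʳ : ∀ {n} (f : Fin n → Fin n → ℕ) c → ∑∑ (λ i j → f i j * c) ≡ ∑∑ f * c
  ∑∑-*ʳ {n} f c = trans (sum-cong-≗ {n} (λ i → sym (*-distribʳ-sum c (f i))))
                        (sym (*-distribʳ-sum c (sum ∘ f)))

  ∑∑∑-*ʳ : ∀ {n} (f : Fin n → Fin n → Fin n → ℕ) c → ∑∑∑ (λ i j k → f i j k * c) ≡ ∑∑∑ f * c
  ∑∑∑-*ʳ {n} f c = trans (sum-cong-≗ {n} (λ i → ∑∑-*ʳ (f i) c))
                         (sym (*-distribʳ-sum c (∑∑ ∘ f)))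

  ΣP-*ˡ : ∀ n a (f : Permutation′ n → ℕ) → ΣP n (λ π → a * f π) ≡ a * ΣP n f
  ΣP-*ˡ n a f = sym (*-distribˡ-ΣP n a f)

  ΣP-ordered₂ : ∀ {a} (c : ℕ) (h : Fin (2 + a) → Fin (2 + a) → ℕ) → (∀ z → h z z ≡ 0) → ∀ i j →
                ΣP (2 + a) (λ π → 𝟙[ i < j ] * (c * h (π ⟨$⟩ʳ i) (π ⟨$⟩ʳ j)))
                  ≡ 𝟙[ i < j ] * c * ((a !) * ∑∑ h)
  ΣP-ordered₂ {a} c h h-diag i j = begin
    ΣP (2 + a) (λ π → 𝟙[ i < j ] * (c * h (π ⟨$⟩ʳ i) (π ⟨$⟩ʳ j)))
      ≡⟨ ΣP-*ˡ (2 + a) 𝟙[ i < j ] (λ π → c * h (π ⟨$⟩ʳ i) (π ⟨$⟩ʳ j)) ⟩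
    𝟙[ i < j ] * ΣP (2 + a) (λ π → c * h (π ⟨$⟩ʳ i) (π ⟨$⟩ʳ j))
      ≡⟨ cong (𝟙[ i < j ] *_) (ΣP-*ˡ (2 + a) c (λ π → h (π ⟨$⟩ʳ i) (π ⟨$⟩ʳ j))) ⟩
    𝟙[ i < j ] * (c * ΣP (2 + a) (λ π → h (π ⟨$⟩ʳ i) (π ⟨$⟩ʳ j)))
      ≡⟨ 𝟙[<]-guard i j (λ i<j → cong (c *_) (ΣP-image₂ i<j h h-diag)) ⟩
    𝟙[ i < j ] * (c * ((a !) * ∑∑ h))
      ≡⟨ ℕ.*-assoc 𝟙[ i < j ] c _ ⟨
    𝟙[ i < j ] * c * ((a !) * ∑∑ h) ∎
    where open ≡-Reasoning

  ΣP-sorted₃ : ∀ {a} (c h : Fin (3 + a) → Fin (3 + a) → Fin (3 + a) → ℕ) → Diagonal-free h → ∀ i j k →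
               ΣP (3 + a) (λ π → sorted (λ x y z → c x y z * h (π ⟨$⟩ʳ x) (π ⟨$⟩ʳ y) (π ⟨$⟩ʳ z)) i j k)
                 ≡ sorted c i j k * ((a !) * ∑∑∑ h)
  ΣP-sorted₃ {a} c h h-diag i j k = begin
    ΣP (3 + a) (λ π → 𝟙[ i < j ] * (𝟙[ j < k ] * (c i j k * H π)))
      ≡⟨ ΣP-*ˡ (3 + a) 𝟙[ i < j ] (λ π → 𝟙[ j < k ] * (c i j k * H π)) ⟩
    𝟙[ i < j ] * ΣP (3 + a) (λ π → 𝟙[ j < k ] * (c i j k * H π))
      ≡⟨ cong (𝟙[ i < j ] *_) (ΣP-*ˡ (3 + a) 𝟙[ j < k ] (λ π → c i j k * H π)) ⟩
    𝟙[ i < j ] * (𝟙[ j < k ] * ΣP (3 + a) (λ π → c i j k * H π))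
      ≡⟨ cong (λ v → 𝟙[ i < j ] * (𝟙[ j < k ] * v)) (ΣP-*ˡ (3 + a) (c i j k) H) ⟩
    𝟙[ i < j ] * (𝟙[ j < k ] * (c i j k * ΣP (3 + a) H))
      ≡⟨ 𝟙[<]-guard i j (λ i<j → 𝟙[<]-guard j k (λ j<k → cong (c i j k *_) (ΣP-image₃ i<j j<k h h-diag))) ⟩
    𝟙[ i < j ] * (𝟙[ j < k ] * (c i j k * ((a !) * ∑∑∑ h)))
      ≡⟨ reassociate 𝟙[ i < j ] 𝟙[ j < k ] (c i j k) _ ⟩
    sorted c i j k * ((a !) * ∑∑∑ h) ∎
    where
    open ≡-Reasoning
    H : Permutation′ (3 + a) → ℕ
    H π = h (π ⟨$⟩ʳ i) (π ⟨$⟩ʳ j) (π ⟨$⟩ʳ k)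
    reassociate : ∀ u v w x → u * (v * (w * x)) ≡ u * (v * w) * x
    reassociate = solve-∀

  pairCount : ∀ {n} → PairSet n → ℕ
  pairCount S = ∑∑ (λ i j → 𝟙[ i < j ] * edge S i j)

  triangleCount : ∀ {n} → PairSet n → ℕ
  triangleCount S = ∑∑∑ (sorted (triangle S))

  ΣP-sampledEdges : ∀ {a} (G : Graph (2 + a)) (S : PairSet (2 + a)) →
                    ΣP (2 + a) (λ π → sampledEdges (permute π G) S)
                      ≡ pairCount S * ((a !) * (2 * edgeCount G))
  ΣP-sampledEdges {a} G S = begin
    ΣP (2 + a) (λ π → sampledEdges (permute π G) S)
      ≡⟨ ΣP-cong (2 + a) (λ π → trans (count-pairs (2 + a) (sampled π)) (sum-cong-≗ {2 + a} (λ i → sum-cong-≗ {2 + a} (λ j →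
           cong (𝟙[ i < j ] *_) (𝟙-∧-comm (adj G (π ⟨$⟩ʳ i) (π ⟨$⟩ʳ j)) (S i j)))))) ⟩
    ΣP (2 + a) (λ π → ∑∑ (λ i j → 𝟙[ i < j ] * (edge S i j * E π i j)))
      ≡⟨ ΣP-∑∑ (2 + a) (λ π i j → 𝟙[ i < j ] * (edge S i j * E π i j)) ⟩
    ∑∑ (λ i j → ΣP (2 + a) (λ π → 𝟙[ i < j ] * (edge S i j * E π i j)))
      ≡⟨ sum-cong-≗ {2 + a} (λ i → sum-cong-≗ {2 + a} (λ j →
           ΣP-ordered₂ (edge S i j) (edge (adj G)) (λ z → cong 𝟙 (irrefl G z)) i j)) ⟩
    ∑∑ (λ i j → 𝟙[ i < j ] * edge S i j * ((a !) * ∑∑ (edge (adj G))))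
      ≡⟨ ∑∑-*ʳ (λ i j → 𝟙[ i < j ] * edge S i j) _ ⟩
    pairCount S * ((a !) * ∑∑ (edge (adj G)))
      ≡⟨ cong (λ e → pairCount S * ((a !) * e)) (∑∑-edge G) ⟩
    pairCount S * ((a !) * (2 * edgeCount G)) ∎
    where
    open ≡-Reasoning
    sampled : Permutation′ (2 + a) → Fin (2 + a) × Fin (2 + a) → Bool
    sampled π (i , j) = adj G (π ⟨$⟩ʳ i) (π ⟨$⟩ʳ j) ∧ S i j
    E : Permutation′ (2 + a) → Fin (2 + a) → Fin (2 + a) → ℕ
    E π i j = edge (adj G) (π ⟨$⟩ʳ i) (π ⟨$⟩ʳ j)

  ΣP-samplesTriangle-≤ : ∀ {a} (G : Graph (3 + a)) (S : PairSet (3 + a)) →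
                         ΣP (3 + a) (λ π → 𝟙 (samplesTriangle (permute π G) S))
                           ≤ triangleCount S * ((a !) * (6 * triCount G))
  ΣP-samplesTriangle-≤ {a} G S = begin
    ΣP (3 + a) (λ π → 𝟙 (samplesTriangle (permute π G) S))
      ≤⟨ ΣP-mono-≤ (3 + a) (λ π → 𝟙-any≤count (sampled π) (triples (3 + a))) ⟩
    ΣP (3 + a) (λ π → count (sampled π) (triples (3 + a)))
      ≡⟨ ΣP-cong (3 + a) (λ π → trans (count-triples (3 + a) (sampled π))
           (sum-cong-≗ {3 + a} (λ i → sum-cong-≗ {3 + a} (λ j → sum-cong-≗ {3 + a} (λ k →
             cong (λ v → 𝟙[ i < j ] * (𝟙[ j < k ] * v))
                  (𝟙-∧-comm (adj G (π ⟨$⟩ʳ i) (π ⟨$⟩ʳ j) ∧ adj G (π ⟨$⟩ʳ j) (π ⟨$⟩ʳ k) ∧ adj G (π ⟨$⟩ʳ i) (π ⟨$⟩ʳ k))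
                            (S i j ∧ S j k ∧ S i k))))))) ⟩
    ΣP (3 + a) (λ π → ∑∑∑ (sorted (λ i j k → triangle S i j k * T π i j k)))
      ≡⟨ ΣP-∑∑∑ (3 + a) (λ π → sorted (λ i j k → triangle S i j k * T π i j k)) ⟩
    ∑∑∑ (λ i j k → ΣP (3 + a) (λ π → sorted (λ i j k → triangle S i j k * T π i j k) i j k))
      ≡⟨ sum-cong-≗ {3 + a} (λ i → sum-cong-≗ {3 + a} (λ j → sum-cong-≗ {3 + a} (λ k →
           ΣP-sorted₃ (triangle S) (triangle (adj G)) (triangle-diagonal-free G) i j k))) ⟩
    ∑∑∑ (λ i j k → sorted (triangle S) i j k * ((a !) * ∑∑∑ (triangle (adj G))))
      ≡⟨ ∑∑∑-*ʳ (sorted (triangle S)) _ ⟩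
    triangleCount S * ((a !) * ∑∑∑ (triangle (adj G)))
      ≤⟨ ℕ.*-monoʳ-≤ (triangleCount S) (ℕ.*-monoʳ-≤ (a !) (∑∑∑-triangle G)) ⟩
    triangleCount S * ((a !) * (6 * triCount G)) ∎
    where
    open ℕ.≤-Reasoning
    sampled : Permutation′ (3 + a) → Fin (3 + a) × Fin (3 + a) × Fin (3 + a) → Bool
    sampled π (i , j , k) = (adj G (π ⟨$⟩ʳ i) (π ⟨$⟩ʳ j) ∧ adj G (π ⟨$⟩ʳ j) (π ⟨$⟩ʳ k) ∧ adj G (π ⟨$⟩ʳ i) (π ⟨$⟩ʳ k))
                            ∧ (S i j ∧ S j k ∧ S i k)
    T : Permutation′ (3 + a) → Fin (3 + a) → Fin (3 + a) → Fin (3 + a) → ℕ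
    T π i j k = triangle (adj G) (π ⟨$⟩ʳ i) (π ⟨$⟩ʳ j) (π ⟨$⟩ʳ k)

  *-≤1ʳ : ∀ a {b} → b ≤ 1 → a * b ≤ a
  *-≤1ʳ a b≤1 = ℕ.≤-trans (ℕ.*-monoʳ-≤ a b≤1) (ℕ.≤-reflexive (ℕ.*-identityʳ a))

  *-≤1ˡ : ∀ {a} b → a ≤ 1 → a * b ≤ b
  *-≤1ˡ {a} b a≤1 = ℕ.≤-trans (ℕ.≤-reflexive (ℕ.*-comm a b)) (*-≤1ʳ b a≤1)

  𝟙[<]-asym : ∀ {n} (x y : Fin n) → 𝟙[ x < y ] + 𝟙[ y < x ] ≤ 1
  𝟙[<]-asym x y with x <? y | y <? x
  ... | yes x<y | yes y<x = contradiction y<x (<-asym x<y)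
  ... | yes _ | no _ = s≤s z≤n
  ... | no _  | _    = 𝟙≤1 _

  ∑∑∑-product : ∀ {n} (f g h : Fin n → ℕ) → ∑∑∑ (λ x y z → f x * (g y * h z)) ≡ sum f * (sum g * sum h)
  ∑∑∑-product {n} f g h = begin
    ∑[ x < n ] ∑[ y < n ] ∑[ z < n ] (f x * (g y * h z))
      ≡⟨ sum-cong-≗ {n} (λ x → sum-cong-≗ {n} (λ y → trans (sym (*-distribˡ-sum (f x) (λ z → g y * h z)))
                                                            (cong (f x *_) (sym (*-distribˡ-sum (g y) h))))) ⟩
    ∑[ x < n ] ∑[ y < n ] (f x * (g y * sum h))
      ≡⟨ sum-cong-≗ {n} (λ x → trans (sym (*-distribˡ-sum (f x) (λ y → g y * sum h)))
                                     (cong (f x *_) (sym (*-distribʳ-sum (sum h) g)))) ⟩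
    ∑[ x < n ] (f x * (sum g * sum h))
      ≡⟨ *-distribʳ-sum (sum g * sum h) f ⟨
    sum f * (sum g * sum h) ∎
    where open ≡-Reasoning

  -- Every triangle has a vertex of degree at most D, or all three of its vertices have larger degree.
  cover : ∀ a b c → 1 ≤ 𝟙 a + 𝟙 b + 𝟙 c + 𝟙 (not a) * (𝟙 (not b) * 𝟙 (not c))
  cover true  b     c     = s≤s z≤n
  cover false true  c     = s≤s z≤n
  cover false false true  = s≤s z≤n
  cover false false false = s≤s z≤n

  module _ {n} (S : PairSet n) where

    -- S as a symmetric 0/1 adjacency matrix; only the entries S i j with i < j are read.
    Ŝ : Fin n → Fin n → ℕ
    Ŝ x y = 𝟙[ x < y ] * edge S x y + 𝟙[ y < x ] * edge S y x

    Ŝ-sym : ∀ x y → Ŝ x y ≡ Ŝ y x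
    Ŝ-sym x y = ℕ.+-comm (𝟙[ x < y ] * edge S x y) _

    Ŝ≤1 : ∀ x y → Ŝ x y ≤ 1
    Ŝ≤1 x y = ℕ.≤-trans (ℕ.+-mono-≤ (*-≤1ʳ 𝟙[ x < y ] (𝟙≤1 (S x y))) (*-≤1ʳ 𝟙[ y < x ] (𝟙≤1 (S y x))))
                        (𝟙[<]-asym x y)

    degree : Fin n → ℕ
    degree x = sum (Ŝ x)

    ∑-degree : sum degree ≡ 2 * pairCount S
    ∑-degree = begin
      ∑∑ Ŝ
        ≡⟨ ∑∑-distrib-+ (λ x y → 𝟙[ x < y ] * edge S x y) (λ x y → 𝟙[ y < x ] * edge S y x) ⟩
      pairCount S + ∑∑ (λ x y → 𝟙[ y < x ] * edge S y x)
        ≡⟨ cong (pairCount S +_) (∑-comm (λ x y → 𝟙[ y < x ] * edge S y x)) ⟩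
      pairCount S + pairCount S
        ≡⟨ cong (pairCount S +_) (ℕ.+-identityʳ (pairCount S)) ⟨
      2 * pairCount S ∎
      where open ≡-Reasoning

    wedges : Fin n → Fin n → Fin n → ℕ
    wedges x y z = Ŝ x y * (Ŝ y z * Ŝ x z)

    triangleCount≤wedges : triangleCount S ≤ ∑∑∑ wedges
    triangleCount≤wedges = ∑∑∑-mono-≤ pointwise
      where
      edge≤Ŝ : ∀ {x y} → x Fin.< y → edge S x y ≤ Ŝ x y
      edge≤Ŝ {x} {y} x<y rewrite 𝟙[<]-yes x<y =
        ℕ.≤-trans (ℕ.≤-reflexive (sym (ℕ.+-identityʳ (edge S x y)))) (ℕ.m≤m+n _ _)
      pointwise : ∀ i j k → sorted (triangle S) i j k ≤ wedges i j k
      pointwise i j k = by-order (i <? j) (j <? k)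
        where
        by-order : Dec (i Fin.< j) → Dec (j Fin.< k) → sorted (triangle S) i j k ≤ wedges i j k
        by-order (no i≮j) _ = ℕ.≤-trans (ℕ.≤-reflexive (sorted-no₁ (triangle S) k i≮j)) z≤n
        by-order (yes _) (no j≮k) = ℕ.≤-trans (ℕ.≤-reflexive (sorted-no₂ (triangle S) i j≮k)) z≤n
        by-order (yes i<j) (yes j<k) = begin
          sorted (triangle S) i j k
            ≡⟨ sorted-yes (triangle S) i<j j<k ⟩
          𝟙 (S i j ∧ S j k ∧ S i k)
            ≡⟨ trans (𝟙-∧ (S i j) _) (cong (edge S i j *_) (𝟙-∧ (S j k) (S i k))) ⟩
          edge S i j * (edge S j k * edge S i k)
            ≤⟨ ℕ.*-mono-≤ (edge≤Ŝ i<j) (ℕ.*-mono-≤ (edge≤Ŝ j<k) (edge≤Ŝ (<-trans i<j j<k))) ⟩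
          wedges i j k ∎
          where open ℕ.≤-Reasoning

    wedges≤1 : ∀ i j k → wedges i j k ≤ 1
    wedges≤1 i j k = ℕ.≤-trans (*-≤1ˡ _ (Ŝ≤1 i j)) (ℕ.≤-trans (*-≤1ˡ _ (Ŝ≤1 j k)) (Ŝ≤1 i k))

    module _ (D : ℕ) where

      low high : Fin n → ℕ
      low x  = 𝟙 ⌊ degree x ℕ.≤? D ⌋
      high x = 𝟙 (not ⌊ degree x ℕ.≤? D ⌋)

      low-degree : ∀ x → low x * degree x ≤ D
      low-degree x with degree x ℕ.≤? D
      ... | yes d≤D = ℕ.≤-trans (ℕ.≤-reflexive (ℕ.+-identityʳ (degree x))) d≤D
      ... | no  _   = z≤n

      high-degree : ∀ x → high x * suc D ≤ degree x
      high-degree x with degree x ℕ.≤? D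
      ... | yes _   = z≤n
      ... | no  d≰D = ℕ.≤-trans (ℕ.≤-reflexive (ℕ.+-identityʳ (suc D))) (ℕ.≰⇒> d≰D)

      lowWedges : Fin n → Fin n → Fin n → ℕ
      lowWedges x y z = low x * (Ŝ x y * Ŝ x z)

      ∑∑∑-lowWedges : ∑∑∑ lowWedges ≤ D * (2 * pairCount S)
      ∑∑∑-lowWedges = begin
        ∑[ x < n ] ∑[ y < n ] ∑[ z < n ] (low x * (Ŝ x y * Ŝ x z))
          ≡⟨ sum-cong-≗ {n} (λ x → centre x) ⟩
        ∑[ x < n ] ((low x * degree x) * degree x)
          ≤⟨ ∑-mono-≤ (λ x → ℕ.*-monoˡ-≤ (degree x) (low-degree x)) ⟩
        ∑[ x < n ] (D * degree x)
          ≡⟨ *-distribˡ-sum D degree ⟨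
        D * sum degree
          ≡⟨ cong (D *_) ∑-degree ⟩
        D * (2 * pairCount S) ∎
        where
        open ℕ.≤-Reasoning
        centre : ∀ x → ∑∑ (lowWedges x) ≡ (low x * degree x) * degree x
        centre x = begin-equality
          ∑[ y < n ] ∑[ z < n ] (low x * (Ŝ x y * Ŝ x z))
            ≡⟨ sum-cong-≗ {n} (λ y → trans (sum-cong-≗ {n} (λ z → sym (ℕ.*-assoc (low x) (Ŝ x y) (Ŝ x z))))
                                           (sym (*-distribˡ-sum (low x * Ŝ x y) (Ŝ x)))) ⟩
          ∑[ y < n ] (low x * Ŝ x y * degree x)
            ≡⟨ *-distribʳ-sum (degree x) (λ y → low x * Ŝ x y) ⟨
          ∑[ y < n ] (low x * Ŝ x y) * degree x
            ≡⟨ cong (_* degree x) (*-distribˡ-sum (low x) (Ŝ x)) ⟨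
          (low x * degree x) * degree x ∎

      high-count : sum high * suc D ≤ 2 * pairCount S
      high-count = begin
        sum high * suc D            ≡⟨ *-distribʳ-sum (suc D) high ⟩
        ∑[ x < n ] (high x * suc D) ≤⟨ ∑-mono-≤ high-degree ⟩
        sum degree                  ≡⟨ ∑-degree ⟩
        2 * pairCount S             ∎
        where open ℕ.≤-Reasoning

      highTriples : Fin n → Fin n → Fin n → ℕ
      highTriples x y z = high x * (high y * high z)

      ∑∑∑-highTriples : ∑∑∑ highTriples ≡ sum high * (sum high * sum high)
      ∑∑∑-highTriples = ∑∑∑-product high high high

      wedges-split : ∀ i j k → wedges i j k ≤ lowWedges i j k + lowWedges j i k + lowWedges k i j
                                             + highTriples i j k
      wedges-split i j k = begin
        w
          ≡⟨ ℕ.*-identityˡ w ⟨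
        1 * w
          ≤⟨ ℕ.*-monoˡ-≤ w (cover ⌊ degree i ℕ.≤? D ⌋ ⌊ degree j ℕ.≤? D ⌋ ⌊ degree k ℕ.≤? D ⌋) ⟩
        (low i + low j + low k + highTriples i j k) * w
          ≡⟨ distribute (low i) (low j) (low k) (highTriples i j k) w ⟩
        low i * w + low j * w + low k * w + highTriples i j k * w
          ≤⟨ ℕ.+-mono-≤ (ℕ.+-mono-≤ (ℕ.+-mono-≤ at-i at-j) at-k) (*-≤1ʳ _ (wedges≤1 i j k)) ⟩
        lowWedges i j k + lowWedges j i k + lowWedges k i j + highTriples i j k ∎
        where
        open ℕ.≤-Reasoning
        w : ℕ
        w = wedges i j k
        distribute : ∀ a b c d x → (a + b + c + d) * x ≡ a * x + b * x + c * x + d * x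
        distribute = solve-∀
        at-i : low i * w ≤ lowWedges i j k
        at-i = ℕ.*-monoʳ-≤ (low i) (ℕ.*-monoʳ-≤ (Ŝ i j) (*-≤1ˡ (Ŝ i k) (Ŝ≤1 j k)))
        at-j : low j * w ≤ lowWedges j i k
        at-j = ℕ.*-monoʳ-≤ (low j) (ℕ.≤-trans (ℕ.*-monoʳ-≤ (Ŝ i j) (*-≤1ʳ (Ŝ j k) (Ŝ≤1 i k)))
                                              (ℕ.≤-reflexive (cong (_* Ŝ j k) (Ŝ-sym i j))))
        at-k : low k * w ≤ lowWedges k i j
        at-k = ℕ.*-monoʳ-≤ (low k) (ℕ.≤-trans (*-≤1ˡ (Ŝ j k * Ŝ i k) (Ŝ≤1 i j))
                                              (ℕ.≤-reflexive (trans (ℕ.*-comm (Ŝ j k) (Ŝ i k))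
                                                                    (cong₂ _*_ (Ŝ-sym i k) (Ŝ-sym j k)))))

      ∑∑∑-wedges : ∑∑∑ wedges ≤ 3 * (D * (2 * pairCount S)) + sum high * (sum high * sum high)
      ∑∑∑-wedges = begin
        ∑∑∑ wedges
          ≤⟨ ∑∑∑-mono-≤ wedges-split ⟩
        ∑∑∑ (λ i j k → lowWedges i j k + lowWedges j i k + lowWedges k i j + highTriples i j k)
          ≡⟨ distribute ⟩
        ∑∑∑ lowWedges + ∑∑∑ (λ i j k → lowWedges j i k) + ∑∑∑ (λ i j k → lowWedges k i j) + ∑∑∑ highTriples
          ≡⟨ cong₂ (λ u v → ∑∑∑ lowWedges + u + v + ∑∑∑ highTriples) swap₁₂ rotate ⟩
        ∑∑∑ lowWedges + ∑∑∑ lowWedges + ∑∑∑ lowWedges + ∑∑∑ highTriples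
          ≤⟨ ℕ.+-mono-≤ (ℕ.+-mono-≤ (ℕ.+-mono-≤ ∑∑∑-lowWedges ∑∑∑-lowWedges) ∑∑∑-lowWedges)
                        (ℕ.≤-reflexive ∑∑∑-highTriples) ⟩
        X + X + X + sum high * (sum high * sum high)
          ≡⟨ cong (_+ sum high * (sum high * sum high)) (thrice X) ⟩
        3 * X + sum high * (sum high * sum high) ∎
        where
        open ℕ.≤-Reasoning
        X : ℕ
        X = D * (2 * pairCount S)
        thrice : ∀ x → x + x + x ≡ 3 * x
        thrice = solve-∀
        swap₁₂ : ∑∑∑ (λ i j k → lowWedges j i k) ≡ ∑∑∑ lowWedges
        swap₁₂ = ∑-comm (λ i j → ∑[ k < n ] lowWedges j i k)
        rotate : ∑∑∑ (λ i j k → lowWedges k i j) ≡ ∑∑∑ lowWedges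
        rotate = trans (sum-cong-≗ {n} (λ i → ∑-comm (λ j k → lowWedges k i j)))
                       (∑-comm (λ i k → ∑[ j < n ] lowWedges k i j))
        distribute : ∑∑∑ (λ i j k → lowWedges i j k + lowWedges j i k + lowWedges k i j + highTriples i j k)
                     ≡ ∑∑∑ lowWedges + ∑∑∑ (λ i j k → lowWedges j i k) + ∑∑∑ (λ i j k → lowWedges k i j)
                       + ∑∑∑ highTriples
        distribute = trans (∑∑∑-distrib-+ (λ i j k → lowWedges i j k + lowWedges j i k + lowWedges k i j) highTriples)
                    (cong (_+ ∑∑∑ highTriples)
                      (trans (∑∑∑-distrib-+ (λ i j k → lowWedges i j k + lowWedges j i k) (λ i j k → lowWedges k i j))
                             (cong (_+ ∑∑∑ (λ i j k → lowWedges k i j))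
                                   (∑∑∑-distrib-+ lowWedges (λ i j k → lowWedges j i k)))))

  ⌊root⌋ : ∀ k .{{_ : NonZero k}} N → ∃[ r ] (r ^ k ≤ N × N < suc r ^ k)
  ⌊root⌋ (suc k) zero = 0 , z≤n , ℕ.≤-reflexive (sym (ℕ.^-zeroˡ (suc k)))
  ⌊root⌋ k (suc N) with ⌊root⌋ k N
  ... | r , rᵏ≤N , N<[1+r]ᵏ with suc r ^ k ℕ.≤? suc N
  ...   | yes [1+r]ᵏ≤1+N = suc r , [1+r]ᵏ≤1+N , ℕ.≤-<-trans N<[1+r]ᵏ (ℕ.^-monoˡ-< k (ℕ.n<1+n (suc r)))
  ...   | no  [1+r]ᵏ≰1+N = r , ℕ.m≤n⇒m≤1+n rᵏ≤N , ℕ.≰⇒> [1+r]ᵏ≰1+N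

  ^-cancelˡ-≤ : ∀ k .{{_ : NonZero k}} {a b} → a ^ k ≤ b ^ k → a ≤ b
  ^-cancelˡ-≤ k {a} {b} aᵏ≤bᵏ with a ℕ.≤? b
  ... | yes a≤b = a≤b
  ... | no  a≰b = contradiction aᵏ≤bᵏ (ℕ.<⇒≱ (ℕ.^-monoˡ-< k (ℕ.≰⇒> a≰b)))

  square-≤-double : ∀ {w} x {c} → w ≤ x + x → x ^ 2 ≤ c → w ^ 2 ≤ 4 * c
  square-≤-double {w} x {c} w≤2x x²≤c = begin
    w ^ 2       ≤⟨ ℕ.^-monoˡ-≤ 2 w≤2x ⟩
    (x + x) ^ 2 ≡⟨ solve 1 (λ x → (x :+ x) :^ 2 := con 4 :* x :^ 2) refl x ⟩
    4 * x ^ 2   ≤⟨ ℕ.*-monoʳ-≤ 4 x²≤c ⟩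
    4 * c       ∎
    where open ℕ.≤-Reasoning

  square-≤-sum : ∀ {w} a b {c} → w ≤ a + b → a ^ 2 ≤ c → b ^ 2 ≤ c → w ^ 2 ≤ 4 * c
  square-≤-sum {w} a b w≤a+b a²≤c b²≤c with ℕ.≤-total a b
  ... | inj₁ a≤b = square-≤-double b (ℕ.≤-trans w≤a+b (ℕ.+-monoˡ-≤ b a≤b)) b²≤c
  ... | inj₂ b≤a = square-≤-double a (ℕ.≤-trans w≤a+b (ℕ.+-monoʳ-≤ a b≤a)) a²≤c

  threshold-arithmetic : ∀ {W s D h} → W ≤ 3 * (D * (2 * s)) + h * (h * h) → h * suc D ≤ 2 * s →
                         D ^ 2 ≤ s → s < suc D ^ 2 → W ^ 2 ≤ 256 * s ^ 3
  threshold-arithmetic {W} {s} {D} {h} W≤ hD≤2s D²≤s s<[1+D]² =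
    ℕ.≤-trans (square-≤-sum (3 * (D * (2 * s))) (h * (h * h)) W≤ low-part high-part)
              (ℕ.≤-reflexive (sym (ℕ.*-assoc 4 64 (s ^ 3))))
    where
    open ℕ.≤-Reasoning
    s≤[1+D]² : s ≤ suc D ^ 2
    s≤[1+D]² = ℕ.<⇒≤ s<[1+D]²
    low-part : (3 * (D * (2 * s))) ^ 2 ≤ 64 * s ^ 3
    low-part = begin
      (3 * (D * (2 * s))) ^ 2 ≡⟨ solve 2 (λ D s → (con 3 :* (D :* (con 2 :* s))) :^ 2 := con 36 :* (D :^ 2 :* s :^ 2)) refl D s ⟩
      36 * (D ^ 2 * s ^ 2)    ≤⟨ ℕ.*-monoʳ-≤ 36 (ℕ.*-monoˡ-≤ (s ^ 2) D²≤s) ⟩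
      36 * (s * s ^ 2)        ≤⟨ ℕ.*-monoˡ-≤ (s * s ^ 2) (ℕ.m≤m+n 36 28) ⟩
      64 * s ^ 3              ∎
    h²≤4s : h ^ 2 ≤ 4 * s
    h²≤4s = ℕ.*-cancelʳ-≤ (h ^ 2) (4 * s) (suc D ^ 2) (begin
      h ^ 2 * suc D ^ 2       ≡⟨ solve 2 (λ h d → h :^ 2 :* d :^ 2 := (h :* d) :^ 2) refl h (suc D) ⟩
      (h * suc D) ^ 2         ≤⟨ ℕ.^-monoˡ-≤ 2 hD≤2s ⟩
      (2 * s) ^ 2             ≡⟨ solve 1 (λ s → (con 2 :* s) :^ 2 := con 4 :* s :* s) refl s ⟩
      4 * s * s               ≤⟨ ℕ.*-monoʳ-≤ (4 * s) s≤[1+D]² ⟩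
      4 * s * suc D ^ 2       ∎)
    high-part : (h * (h * h)) ^ 2 ≤ 64 * s ^ 3
    high-part = begin
      (h * (h * h)) ^ 2 ≡⟨ solve 1 (λ h → (h :* (h :* h)) :^ 2 := (h :^ 2) :^ 3) refl h ⟩
      (h ^ 2) ^ 3       ≤⟨ ℕ.^-monoˡ-≤ 3 h²≤4s ⟩
      (4 * s) ^ 3       ≡⟨ solve 1 (λ s → (con 4 :* s) :^ 3 := con 64 :* s :^ 3) refl s ⟩
      64 * s ^ 3        ∎

  triangleCount-bound : ∀ {n} (S : PairSet n) → triangleCount S ^ 2 ≤ 256 * pairCount S ^ 3
  triangleCount-bound S with ⌊root⌋ 2 (pairCount S)
  ... | D , D²≤s , s<[1+D]² =
    threshold-arithmetic {D = D} {h = sum (high S D)} (ℕ.≤-trans (triangleCount≤wedges S) (∑∑∑-wedges S D)) (high-count S D) D²≤s s<[1+D]²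

  falling-factorial-bound : ∀ a → (3 + a) * (2 + a) ≤ 6 * ((1 + a) * (1 + a))
  falling-factorial-bound a = ℕ.≤-trans (ℕ.m≤m+n _ (5 * (a * a) + 7 * a)) (ℕ.≤-reflexive (expand a))
    where
    expand : ∀ a → (3 + a) * (2 + a) + (5 * (a * a) + 7 * a) ≡ 6 * ((1 + a) * (1 + a))
    expand = solve 1 (λ a → (con 3 :+ a) :* (con 2 :+ a) :+ (con 5 :* (a :* a) :+ con 7 :* a)
                           := con 6 :* ((con 1 :+ a) :* (con 1 :+ a))) refl

  module _ {n} (G : Graph n) (S : PairSet n) where

    hits : ℕ
    hits = ΣP n (λ π → 𝟙 (samplesTriangle (permute π G) S))

    load : ℕ
    load = ΣP n (λ π → sampledEdges (permute π G) S)

  module _ {a} (G : Graph (3 + a)) (S : PairSet (3 + a)) where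

    hits≤permutations : hits G S ≤ (3 + a) !
    hits≤permutations = ℕ.≤-trans (ΣP-mono-≤ (3 + a) (λ π → 𝟙≤1 (samplesTriangle (permute π G) S)))
                                  (ℕ.≤-reflexive (trans (ΣP-const (3 + a) 1) (ℕ.*-identityʳ _)))

    -- hits³ ≤ (3 + a)!·hits² uses both bounds on hits; (3 + a)(2 + a) ≤ 6(1 + a)² absorbs the
    -- factorials against load³, whence 6912 = 256·36·6/8.
    hits-load : (edgeCount G * hits G S) ^ 3 ≤ 6912 * triCount G ^ 2 * load G S ^ 3
    hits-load = begin
      (m * hits G S) ^ 3
        ≡⟨ solve 2 (λ m x → (m :* x) :^ 3 := m :^ 3 :* (x :* x :^ 2)) refl m (hits G S) ⟩
      m ^ 3 * (hits G S * hits G S ^ 2)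
        ≤⟨ ℕ.*-monoʳ-≤ (m ^ 3) (ℕ.*-mono-≤ hits≤permutations (ℕ.^-monoˡ-≤ 2 (ΣP-samplesTriangle-≤ G S))) ⟩
      m ^ 3 * ((3 + a) ! * (t * ((a !) * (6 * T))) ^ 2)
        ≡⟨ solve 5 (λ m x t f T → m :^ 3 :* (x :* (t :* (f :* (con 6 :* T))) :^ 2)
                                := con 36 :* T :^ 2 :* m :^ 3 :* x :* f :^ 2 :* t :^ 2) refl m ((3 + a) !) t (a !) T ⟩
      36 * T ^ 2 * m ^ 3 * (3 + a) ! * (a !) ^ 2 * t ^ 2
        ≤⟨ ℕ.*-monoʳ-≤ (36 * T ^ 2 * m ^ 3 * (3 + a) ! * (a !) ^ 2) (triangleCount-bound S) ⟩
      36 * T ^ 2 * m ^ 3 * (3 + a) ! * (a !) ^ 2 * (256 * s ^ 3)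
        ≡⟨ solve 5 (λ m T s f a → con 36 :* T :^ 2 :* m :^ 3 :* ((con 3 :+ a) :* ((con 2 :+ a) :* ((con 1 :+ a) :* f)))
                                    :* f :^ 2 :* (con 256 :* s :^ 3)
                                 := con 9216 :* ((con 3 :+ a) :* (con 2 :+ a)) :* ((con 1 :+ a) :* (T :^ 2 :* m :^ 3 :* s :^ 3 :* f :^ 3)))
                   refl m T s (a !) a ⟩
      9216 * ((3 + a) * (2 + a)) * ((1 + a) * Z)
        ≤⟨ ℕ.*-monoˡ-≤ ((1 + a) * Z) (ℕ.*-monoʳ-≤ 9216 (falling-factorial-bound a)) ⟩
      9216 * (6 * ((1 + a) * (1 + a))) * ((1 + a) * Z)
        ≡⟨ solve 5 (λ m T s f a → con 9216 :* (con 6 :* ((con 1 :+ a) :* (con 1 :+ a))) :* ((con 1 :+ a) :* (T :^ 2 :* m :^ 3 :* s :^ 3 :* f :^ 3))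
                                 := con 6912 :* T :^ 2 :* (s :* (((con 1 :+ a) :* f) :* (con 2 :* m))) :^ 3)
                   refl m T s (a !) a ⟩
      6912 * T ^ 2 * (s * ((1 + a) ! * (2 * m))) ^ 3
        ≡⟨ cong (λ l → 6912 * T ^ 2 * l ^ 3) (ΣP-sampledEdges G S) ⟨
      6912 * T ^ 2 * load G S ^ 3 ∎
      where
      open ℕ.≤-Reasoning
      m T s t Z : ℕ
      m = edgeCount G
      T = triCount G
      s = pairCount S
      t = triangleCount S
      Z = T ^ 2 * m ^ 3 * s ^ 3 * (a !) ^ 3

  suc-cube-≤ : ∀ r {N} → 1 ≤ N → r ^ 3 ≤ N → suc r ^ 3 ≤ 8 * N
  suc-cube-≤ zero {N} 1≤N _ = ℕ.≤-trans 1≤N (ℕ.m≤m+n N (7 * N))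
  suc-cube-≤ (suc r) {N} _ r³≤N = begin
    (1 + suc r) ^ 3       ≤⟨ ℕ.^-monoˡ-≤ 3 (ℕ.+-monoˡ-≤ (suc r) (s≤s (z≤n {r}))) ⟩
    (suc r + suc r) ^ 3   ≡⟨ solve 1 (λ x → (x :+ x) :^ 3 := con 8 :* x :^ 3) refl (suc r) ⟩
    8 * suc r ^ 3     ≤⟨ ℕ.*-monoʳ-≤ 8 r³≤N ⟩
    8 * N             ∎
    where open ℕ.≤-Reasoning

  κ : ℕ → ℕ
  κ T = suc (proj₁ (⌊root⌋ 3 (6912 * T ^ 2)))

  κ-bound : ∀ T → 1 ≤ T → κ T ^ 3 ≤ 64000 * T ^ 2
  κ-bound T 1≤T = begin
    κ T ^ 3             ≤⟨ suc-cube-≤ (proj₁ root) (ℕ.≤-trans (ℕ.^-monoˡ-≤ 2 1≤T) (ℕ.m≤n*m (T ^ 2) 6912)) (proj₁ (proj₂ root)) ⟩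
    8 * (6912 * T ^ 2)  ≡⟨ ℕ.*-assoc 8 6912 (T ^ 2) ⟨
    55296 * T ^ 2       ≤⟨ ℕ.*-monoˡ-≤ (T ^ 2) (ℕ.m≤m+n 55296 8704) ⟩
    64000 * T ^ 2       ∎
    where
    open ℕ.≤-Reasoning
    root : ∃[ r ] (r ^ 3 ≤ 6912 * T ^ 2 × 6912 * T ^ 2 < suc r ^ 3)
    root = ⌊root⌋ 3 (6912 * T ^ 2)

  module _ {a} (G : Graph (3 + a)) (S : PairSet (3 + a)) where

    hits-load-linear : edgeCount G * hits G S ≤ κ (triCount G) * load G S
    hits-load-linear = ^-cancelˡ-≤ 3 (begin
      (edgeCount G * hits G S) ^ 3            ≤⟨ hits-load G S ⟩
      6912 * T ^ 2 * load G S ^ 3             ≤⟨ ℕ.*-monoˡ-≤ (load G S ^ 3) (ℕ.<⇒≤ (proj₂ (proj₂ (⌊root⌋ 3 (6912 * T ^ 2))))) ⟩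
      κ T ^ 3 * load G S ^ 3                  ≡⟨ solve 2 (λ k l → k :^ 3 :* l :^ 3 := (k :* l) :^ 3) refl (κ T) (load G S) ⟩
      (κ T * load G S) ^ 3                    ∎)
      where
      open ℕ.≤-Reasoning
      T : ℕ
      T = triCount G

module Sampling where

  open Counting using (ΣP; sum; 𝟙; 𝟙≤1; hits; load; κ; κ-bound; hits-load-linear)
  open import Algebra.Bundles using (CommutativeRing)
  open import Data.Nat as ℕ using (ℕ; zero; suc; _!; _^_; z≤n; s≤s)
  import Data.Nat.Properties as ℕ
  open import Data.Nat.Coprimality using (1-coprimeTo) renaming (sym to coprime-sym)
  open import Data.Integer as ℤ using (+_)
  import Data.Integer.Properties as ℤ
  open import Data.Rational as ℚ using (ℚ; 0ℚ; 1ℚ; _+_; _*_; _≤_; _<_; mkℚ; _/_; *≤*)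
  import Data.Rational.Properties as ℚ
  open import Data.Rational.Solver using (module +-*-Solver)
  open +-*-Solver using (solve; _:*_; _:=_)
  open import Data.Bool using (Bool; true; false; _∧_; if_then_else_)
  open import Data.Bool.ListAction using (any)
  open import Data.Fin using (Fin; zero; suc)
  open import Data.Fin.Permutation as Perm using (Permutation′; insert)
  open import Data.List using (List; []; _∷_; foldr)
  open import Data.List.Relation.Unary.All using (All; []; _∷_)
  open import Data.Product using (_×_; _,_; proj₁; proj₂; ∃-syntax)
  open import Data.Sum using (inj₁; inj₂)
  open import Data.Empty using (⊥-elim)
  open import Function using (_∘_)
  open import Relation.Nullary using (Dec; yes; no)
  open import Relation.Binary.PropositionalEquality

  module ℚΣ = PermutationSum (CommutativeRing.commutativeSemiring ℚ.+-*-commutativeRing)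
  open ℚΣ using (weighted)
  open import Algebra.Properties.Monoid.Mult ℚ.+-0-monoid using (×-assocˡ) renaming (_×_ to _·_)

  toℚ≡mkℚ : ∀ k → toℚ k ≡ mkℚ (+ k) 0 (coprime-sym (1-coprimeTo k))
  toℚ≡mkℚ k = ℚ.normalize-coprime (coprime-sym (1-coprimeTo k))

  toℚ-+ : ∀ a b → toℚ (a ℕ.+ b) ≡ toℚ a + toℚ b
  toℚ-+ a b rewrite toℚ≡mkℚ a | toℚ≡mkℚ b =
    cong (_/ 1) (sym (cong₂ ℤ._+_ (ℤ.*-identityʳ (+ a)) (ℤ.*-identityʳ (+ b))))

  toℚ-* : ∀ a b → toℚ (a ℕ.* b) ≡ toℚ a * toℚ b
  toℚ-* a b rewrite toℚ≡mkℚ a | toℚ≡mkℚ b = cong (_/ 1) (ℤ.pos-* a b)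

  toℚ-mono-≤ : ∀ {a b} → a ℕ.≤ b → toℚ a ≤ toℚ b
  toℚ-mono-≤ {a} {b} a≤b rewrite toℚ≡mkℚ a | toℚ≡mkℚ b =
    *≤* (subst₂ ℤ._≤_ (sym (ℤ.*-identityʳ (+ a))) (sym (ℤ.*-identityʳ (+ b))) (ℤ.+≤+ a≤b))

  toℚ-nonNeg : ∀ k → 0ℚ ≤ toℚ k
  toℚ-nonNeg k = toℚ-mono-≤ {0} {k} ℕ.z≤n

  toℚ-pos : ∀ k → 0ℚ < toℚ (suc k)
  toℚ-pos k = ℚ.positive⁻¹ (toℚ (suc k)) {{ℚ.normalize-pos (suc k) 1}}

  ·≡toℚ* : ∀ k p → k · p ≡ toℚ k * p
  ·≡toℚ* zero    p = sym (ℚ.*-zeroˡ p)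
  ·≡toℚ* (suc k) p = begin
    p + k · p              ≡⟨ cong (λ q → p + q) (·≡toℚ* k p) ⟩
    p + toℚ k * p          ≡⟨ cong (_+ toℚ k * p) (ℚ.*-identityˡ p) ⟨
    1ℚ * p + toℚ k * p     ≡⟨ ℚ.*-distribʳ-+ p 1ℚ (toℚ k) ⟨
    (1ℚ + toℚ k) * p       ≡⟨ cong (_* p) (toℚ-+ 1 k) ⟨
    toℚ (suc k) * p        ∎
    where open ≡-Reasoning

  ΣPℚ-const : ∀ n p → ℚΣ.ΣP n (λ _ → p) ≡ toℚ (n !) * p
  ΣPℚ-const n p = trans (ℚΣ.ΣP-const n p) (·≡toℚ* (n !) p)

  ΣPℚ-mono-≤ : ∀ n {f g : Permutation′ n → ℚ} → (∀ π → f π ≤ g π) → ℚΣ.ΣP n f ≤ ℚΣ.ΣP n g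
  ΣPℚ-mono-≤ = ℚΣ.ΣP-mono {_≤_ = _≤_} ℚ.≤-refl ℚ.+-mono-≤

  sum-toℚ : ∀ {n} (f : Fin n → ℕ) → ℚΣ.sum (toℚ ∘ f) ≡ toℚ (sum f)
  sum-toℚ {zero}  f = refl
  sum-toℚ {suc n} f = trans (cong (λ q → toℚ (f zero) + q) (sum-toℚ (f ∘ suc))) (sym (toℚ-+ (f zero) _))

  ΣP-toℚ : ∀ n (f : Permutation′ n → ℕ) → ℚΣ.ΣP n (toℚ ∘ f) ≡ toℚ (ΣP n f)
  ΣP-toℚ zero    f = refl
  ΣP-toℚ (suc n) f = trans (ℚΣ.sum-cong-≗ {suc n} (λ x → ΣP-toℚ n (f ∘ insert zero x)))
                           (sum-toℚ (λ x → ΣP n (f ∘ insert zero x)))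

  ·-monoʳ-≤ : ∀ k {p q} → p ≤ q → k · p ≤ k · q
  ·-monoʳ-≤ zero    p≤q = ℚ.≤-refl
  ·-monoʳ-≤ (suc k) p≤q = ℚ.+-mono-≤ p≤q (·-monoʳ-≤ k p≤q)

  sum-≤-max : ∀ {n} (g : Fin (suc n) → ℚ) → ∃[ x ] ℚΣ.sum g ≤ suc n · g x
  sum-≤-max {zero}  g = zero , ℚ.≤-refl
  sum-≤-max {suc n} g with sum-≤-max (g ∘ suc)
  ... | x , ∑≤ with ℚ.≤-total (g zero) (g (suc x))
  ...   | inj₁ g₀≤gₓ = suc x , ℚ.+-mono-≤ g₀≤gₓ ∑≤
  ...   | inj₂ gₓ≤g₀ = zero , ℚ.+-monoʳ-≤ (g zero) (ℚ.≤-trans ∑≤ (·-monoʳ-≤ (suc n) gₓ≤g₀))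

  ΣP-≤-max : ∀ n (h : Permutation′ n → ℚ) → ∃[ π ] ℚΣ.ΣP n h ≤ (n !) · h π
  ΣP-≤-max zero    h = Perm.id , ℚ.≤-reflexive (sym (ℚ.+-identityʳ (h Perm.id)))
  ΣP-≤-max (suc n) h = insert zero x (σ x) , (begin
    ℚΣ.sum (λ y → ℚΣ.ΣP n (h ∘ insert zero y))
      ≤⟨ ℚΣ.∑-mono {_≤_ = _≤_} ℚ.≤-refl ℚ.+-mono-≤ (λ y → proj₂ (ΣP-≤-max n (h ∘ insert zero y))) ⟩
    ℚΣ.sum g
      ≤⟨ proj₂ (sum-≤-max g) ⟩
    suc n · ((n !) · h (insert zero x (σ x)))
      ≡⟨ ×-assocˡ (h (insert zero x (σ x))) (suc n) (n !) ⟩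
    (suc n !) · h (insert zero x (σ x)) ∎)
    where
    open ℚ.≤-Reasoning
    σ : Fin (suc n) → Permutation′ n
    σ y = proj₁ (ΣP-≤-max n (h ∘ insert zero y))
    g : Fin (suc n) → ℚ
    g y = (n !) · h (insert zero y (σ y))
    x : Fin (suc n)
    x = proj₁ (sum-≤-max g)

  ΣPℚ-≤-max : ∀ n (h : Permutation′ n → ℚ) → ∃[ π ] ℚΣ.ΣP n h ≤ toℚ (n !) * h π
  ΣPℚ-≤-max n h with ΣP-≤-max n h
  ... | π , ΣPh≤ = π , ℚ.≤-trans ΣPh≤ (ℚ.≤-reflexive (·≡toℚ* (n !) (h π)))

  toℚ-!-pos : ∀ n → 0ℚ < toℚ (n !)
  toℚ-!-pos n = ℚ.<-≤-trans (toℚ-pos 0) (toℚ-mono-≤ (ℕ.1≤n! n))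

  weighted-mono-≤ : ∀ {X : Set} {xs : List (ℚ × X)} → All (λ wx → 0ℚ ≤ proj₁ wx) xs →
                    ∀ {f g : X → ℚ} → (∀ x → f x ≤ g x) → weighted xs f ≤ weighted xs g
  weighted-mono-≤ {xs = []}          []          f≤g = ℚ.≤-refl
  weighted-mono-≤ {xs = (w , x) ∷ _} (0≤w ∷ 0≤ws) f≤g =
    ℚ.+-mono-≤ (ℚ.*-monoˡ-≤-nonNeg w {{ℚ.nonNegative 0≤w}} (f≤g x)) (weighted-mono-≤ 0≤ws f≤g)

  weighted-nonNeg : ∀ {X : Set} {xs : List (ℚ × X)} → All (λ wx → 0ℚ ≤ proj₁ wx) xs →
                    ∀ {f : X → ℚ} → (∀ x → 0ℚ ≤ f x) → 0ℚ ≤ weighted xs f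
  weighted-nonNeg {xs = []}          []          0≤f = ℚ.≤-refl
  weighted-nonNeg {xs = (w , x) ∷ _} (0≤w ∷ 0≤ws) 0≤f =
    ℚ.+-mono-≤ (ℚ.≤-trans (ℚ.≤-reflexive (sym (ℚ.*-zeroʳ w))) (ℚ.*-monoˡ-≤-nonNeg w {{ℚ.nonNegative 0≤w}} (0≤f x)))
               (weighted-nonNeg 0≤ws 0≤f)

  if-then-0 : ∀ b w → (if b then w else 0ℚ) ≡ w * toℚ (𝟙 b)
  if-then-0 true  w = sym (ℚ.*-identityʳ w)
  if-then-0 false w = sym (ℚ.*-zeroʳ w)

  module _ {n} (G : Graph n) where

    foldr-probability : ∀ xs → foldr (λ (w , S) acc → (if samplesTriangle G S then w else 0ℚ) + acc) 0ℚ xs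
                                 ≡ weighted xs (λ S → toℚ (𝟙 (samplesTriangle G S)))
    foldr-probability []             = refl
    foldr-probability ((w , S) ∷ xs) = cong₂ _+_ (if-then-0 (samplesTriangle G S) w) (foldr-probability xs)

    probTriangle≡weighted : ∀ A → probTriangle A G ≡ weighted (support A) (λ S → toℚ (𝟙 (samplesTriangle G S)))
    probTriangle≡weighted A = foldr-probability (support A)

  𝟙-any-∧≤count : ∀ {A : Set} (p q : A → Bool) xs → 𝟙 (any (λ x → p x ∧ q x) xs) ℕ.≤ count p xs
  𝟙-any-∧≤count p q []       = z≤n
  𝟙-any-∧≤count p q (x ∷ xs) with p x
  ... | true  = ℕ.≤-trans (𝟙≤1 _) (s≤s z≤n)
  ... | false = 𝟙-any-∧≤count p q xs

  samplesTriangle≤triCount : ∀ {n} (G : Graph n) S → 𝟙 (samplesTriangle G S) ℕ.≤ triCount G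
  samplesTriangle≤triCount {n} G S =
    𝟙-any-∧≤count (λ (i , j , k) → adj G i j ∧ adj G j k ∧ adj G i k) (λ (i , j , k) → S i j ∧ S j k ∧ S i k)
                  (triples n)

  weighted-zero : ∀ {X : Set} (xs : List (ℚ × X)) → weighted xs (λ _ → 0ℚ) ≡ 0ℚ
  weighted-zero []             = refl
  weighted-zero ((w , _) ∷ xs) = trans (cong₂ _+_ (ℚ.*-zeroʳ w) (weighted-zero xs)) (ℚ.+-identityʳ 0ℚ)

  triangle-free-unsampled : ∀ {n} (G : Graph n) (A : Sampler n) → triCount G ≡ 0 → probTriangle A G ≤ 0ℚ
  triangle-free-unsampled G A T≡0 = begin
    probTriangle A G
      ≡⟨ probTriangle≡weighted G A ⟩
    weighted (support A) (λ S → toℚ (𝟙 (samplesTriangle G S)))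
      ≤⟨ weighted-mono-≤ (nonneg A) (λ S → toℚ-mono-≤ (ℕ.≤-trans (samplesTriangle≤triCount G S) (ℕ.≤-reflexive T≡0))) ⟩
    weighted (support A) (λ _ → 0ℚ)
      ≡⟨ weighted-zero (support A) ⟩
    0ℚ ∎
    where open ℚ.≤-Reasoning

  *-swapˡ : ∀ a b c → a * (b * c) ≡ b * (a * c)
  *-swapˡ a b c = trans (sym (ℚ.*-assoc a b c)) (trans (cong (_* c) (ℚ.*-comm a b)) (ℚ.*-assoc b a c))

  module _ {n} (G : Graph n) (A : Sampler n) where

    ΣP-probTriangle : ℚΣ.ΣP n (λ π → probTriangle A (permute π G)) ≡ weighted (support A) (λ S → toℚ (hits G S))
    ΣP-probTriangle = begin
      ℚΣ.ΣP n (λ π → probTriangle A (permute π G))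
        ≡⟨ ℚΣ.ΣP-cong n (λ π → probTriangle≡weighted (permute π G) A) ⟩
      ℚΣ.ΣP n (λ π → weighted (support A) (λ S → toℚ (𝟙 (samplesTriangle (permute π G) S))))
        ≡⟨ ℚΣ.ΣP-weighted n (support A) (λ π S → toℚ (𝟙 (samplesTriangle (permute π G) S))) ⟩
      weighted (support A) (λ S → ℚΣ.ΣP n (λ π → toℚ (𝟙 (samplesTriangle (permute π G) S))))
        ≡⟨ ℚΣ.weighted-cong (support A) (λ S → ΣP-toℚ n (λ π → 𝟙 (samplesTriangle (permute π G) S))) ⟩
      weighted (support A) (λ S → toℚ (hits G S)) ∎
      where open ≡-Reasoning

    ΣP-expectedEdges : ℚΣ.ΣP n (λ π → expectedEdges A (permute π G)) ≡ weighted (support A) (λ S → toℚ (load G S))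
    ΣP-expectedEdges =
      trans (ℚΣ.ΣP-weighted n (support A) (λ π S → toℚ (sampledEdges (permute π G) S)))
            (ℚΣ.weighted-cong (support A) (λ S → ΣP-toℚ n (λ π → sampledEdges (permute π G) S)))

  -- Yao's principle, with the uniform distribution over relabellings of G as the hard input.
  averaging : ∀ {n} (G : Graph n) (A : Sampler n) {p} k →
              (∀ S → edgeCount G ℕ.* hits G S ℕ.≤ k ℕ.* load G S) →
              (∀ π → p ≤ probTriangle A (permute π G)) →
              ∃[ π ] toℚ (edgeCount G) * p ≤ toℚ k * expectedEdges A (permute π G)
  averaging {n} G A {p} k linear p≤prob = π , ℚ.*-cancelˡ-≤-pos N! {{ℚ.positive (toℚ-!-pos n)}} (begin
    N! * (M * p)
      ≡⟨ *-swapˡ N! M p ⟩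
    M * (N! * p)
      ≡⟨ cong (M *_) (ΣPℚ-const n p) ⟨
    M * ℚΣ.ΣP n (λ _ → p)
      ≤⟨ ℚ.*-monoˡ-≤-nonNeg M {{ℚ.nonNegative (toℚ-nonNeg m)}} (ΣPℚ-mono-≤ n p≤prob) ⟩
    M * ℚΣ.ΣP n (λ π → probTriangle A (permute π G))
      ≡⟨ cong (M *_) (ΣP-probTriangle G A) ⟩
    M * weighted (support A) (λ S → toℚ (hits G S))
      ≡⟨ ℚΣ.*-distribˡ-weighted M (support A) (λ S → toℚ (hits G S)) ⟩
    weighted (support A) (λ S → M * toℚ (hits G S))
      ≤⟨ weighted-mono-≤ (nonneg A) linearℚ ⟩
    weighted (support A) (λ S → K * toℚ (load G S))
      ≡⟨ ℚΣ.*-distribˡ-weighted K (support A) (λ S → toℚ (load G S)) ⟨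
    K * weighted (support A) (λ S → toℚ (load G S))
      ≡⟨ cong (K *_) (ΣP-expectedEdges G A) ⟨
    K * ℚΣ.ΣP n E
      ≤⟨ ℚ.*-monoˡ-≤-nonNeg K {{ℚ.nonNegative (toℚ-nonNeg k)}} (proj₂ (ΣPℚ-≤-max n E)) ⟩
    K * (N! * E π)
      ≡⟨ *-swapˡ K N! (E π) ⟩
    N! * (K * E π) ∎)
    where
    open ℚ.≤-Reasoning
    m : ℕ
    m = edgeCount G
    M K N! : ℚ
    M = toℚ m
    K = toℚ k
    N! = toℚ (n !)
    E : Permutation′ n → ℚ
    E π = expectedEdges A (permute π G)
    π : Permutation′ n
    π = proj₁ (ΣPℚ-≤-max n E)
    linearℚ : ∀ S → M * toℚ (hits G S) ≤ K * toℚ (load G S)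
    linearℚ S = begin
      M * toℚ (hits G S)       ≡⟨ toℚ-* m (hits G S) ⟨
      toℚ (m ℕ.* hits G S)     ≤⟨ toℚ-mono-≤ (linear S) ⟩
      toℚ (k ℕ.* load G S)     ≡⟨ toℚ-* k (load G S) ⟩
      K * toℚ (load G S)       ∎

  *-mono-≤-nonNeg : ∀ {a b c d} → 0ℚ ≤ a → 0ℚ ≤ d → a ≤ b → c ≤ d → a * c ≤ b * d
  *-mono-≤-nonNeg {a} {b} {c} {d} 0≤a 0≤d a≤b c≤d =
    ℚ.≤-trans (ℚ.*-monoˡ-≤-nonNeg a {{ℚ.nonNegative 0≤a}} c≤d) (ℚ.*-monoʳ-≤-nonNeg d {{ℚ.nonNegative 0≤d}} a≤b)

  *-nonNeg : ∀ {a b} → 0ℚ ≤ a → 0ℚ ≤ b → 0ℚ ≤ a * b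
  *-nonNeg {a} 0≤a 0≤b = ℚ.≤-trans (ℚ.≤-reflexive (sym (ℚ.*-zeroʳ a))) (ℚ.*-monoˡ-≤-nonNeg a {{ℚ.nonNegative 0≤a}} 0≤b)

  cube-mono-≤ : ∀ {u v} → 0ℚ ≤ u → u ≤ v → u * u * u ≤ v * v * v
  cube-mono-≤ {u} {v} 0≤u u≤v =
    *-mono-≤-nonNeg (*-nonNeg 0≤u 0≤u) 0≤v (*-mono-≤-nonNeg 0≤u 0≤v u≤v u≤v) u≤v
    where
    0≤v : 0ℚ ≤ v
    0≤v = ℚ.≤-trans 0≤u u≤v

  toℚ-square : ∀ x → toℚ (x ^ 2) ≡ toℚ x * toℚ x
  toℚ-square x = trans (toℚ-* x (x ^ 1)) (cong (toℚ x *_) (trans (toℚ-* x 1) (ℚ.*-identityʳ (toℚ x))))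

  toℚ-cube : ∀ x → toℚ (x ^ 3) ≡ toℚ x * (toℚ x * toℚ x)
  toℚ-cube x = trans (toℚ-* x (x ^ 2)) (cong (toℚ x *_) (toℚ-square x))

  -- 40³ = 64000, the constant of κ-bound.
  r : ℚ
  r = + 1 / 40

  cube-step : ∀ {p M K E T} → 0ℚ ≤ p → 0ℚ ≤ M → 0ℚ ≤ E → M * p ≤ K * E →
              K * (K * K) ≤ toℚ 64000 * (T * T) →
              (p * r * M) * (p * r * M) * (p * r * M) ≤ (E * E * E) * (T * T)
  cube-step {p} {M} {K} {E} {T} 0≤p 0≤M 0≤E Mp≤KE K³≤ = begin
    (p * r * M) * (p * r * M) * (p * r * M)
      ≡⟨ solve 3 (λ p r M → (p :* r :* M) :* (p :* r :* M) :* (p :* r :* M)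
                            := r :* r :* r :* ((M :* p) :* (M :* p) :* (M :* p))) refl p r M ⟩
    r³ * ((M * p) * (M * p) * (M * p))
      ≤⟨ ℚ.*-monoˡ-≤-nonNeg r³ (cube-mono-≤ (*-nonNeg 0≤M 0≤p) Mp≤KE) ⟩
    r³ * ((K * E) * (K * E) * (K * E))
      ≡⟨ cong (r³ *_) (solve 2 (λ K E → (K :* E) :* (K :* E) :* (K :* E) := K :* (K :* K) :* (E :* E :* E)) refl K E) ⟩
    r³ * (K * (K * K) * (E * E * E))
      ≤⟨ ℚ.*-monoˡ-≤-nonNeg r³ (ℚ.*-monoʳ-≤-nonNeg (E * E * E) {{ℚ.nonNegative (*-nonNeg (*-nonNeg 0≤E 0≤E) 0≤E)}} K³≤) ⟩
    r³ * (toℚ 64000 * (T * T) * (E * E * E))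
      ≡⟨ solve 4 (λ c d T E → c :* (d :* (T :* T) :* (E :* E :* E)) := (E :* E :* E) :* (c :* (d :* (T :* T))))
                 refl r³ (toℚ 64000) T E ⟩
    (E * E * E) * (r³ * (toℚ 64000 * (T * T)))
      ≡⟨ cong ((E * E * E) *_) (trans (sym (ℚ.*-assoc r³ (toℚ 64000) (T * T))) (ℚ.*-identityˡ (T * T))) ⟩
    (E * E * E) * (T * T) ∎
    where
    open ℚ.≤-Reasoning
    r³ : ℚ
    r³ = r * r * r

  κ-boundℚ : ∀ T → 1 ℕ.≤ T → toℚ (κ T) * (toℚ (κ T) * toℚ (κ T)) ≤ toℚ 64000 * (toℚ T * toℚ T)
  κ-boundℚ T 1≤T = begin
    toℚ (κ T) * (toℚ (κ T) * toℚ (κ T))   ≡⟨ toℚ-cube (κ T) ⟨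
    toℚ (κ T ^ 3)                         ≤⟨ toℚ-mono-≤ (κ-bound T 1≤T) ⟩
    toℚ (64000 ℕ.* T ^ 2)                 ≡⟨ toℚ-* 64000 (T ^ 2) ⟩
    toℚ 64000 * toℚ (T ^ 2)               ≡⟨ cong (toℚ 64000 *_) (toℚ-square T) ⟩
    toℚ 64000 * (toℚ T * toℚ T)           ∎
    where open ℚ.≤-Reasoning

  Cubic-bound : ∀ (c : ℚ) {n} → Graph n → Sampler n → Set
  Cubic-bound c G A = ∃[ π ] ((c * toℚ (edgeCount G)) * (c * toℚ (edgeCount G)) * (c * toℚ (edgeCount G))
                        ≤ (expectedEdges A (permute π G) * expectedEdges A (permute π G) * expectedEdges A (permute π G))
                          * (toℚ (triCount G) * toℚ (triCount G)))

  module _ {p} (0<p : 0ℚ < p) where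

    scaled-pos : 0ℚ < p * r
    scaled-pos = ℚ.positive⁻¹ (p * r) {{ℚ.pos*pos⇒pos p {{ℚ.positive 0<p}} r}}

    cubic-bound-with-triangles : ∀ {n} (G : Graph n) (A : Sampler n) →
                                 (∀ π → p ≤ probTriangle A (permute π G)) → 1 ℕ.≤ triCount G →
                                 Cubic-bound (p * r) G A
    -- On at most two vertices triCount G computes to 0.
    cubic-bound-with-triangles {zero}                G A p≤prob ()
    cubic-bound-with-triangles {suc zero}           G A p≤prob ()
    cubic-bound-with-triangles {suc (suc zero)}     G A p≤prob ()
    -- The implicit arguments of cube-step are given: inferring them would unfold triCount G.
    cubic-bound-with-triangles {suc (suc (suc a))} G A p≤prob 1≤T =
      π , cube-step {M = toℚ (edgeCount G)} {K = toℚ (κ (triCount G))}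
                    {E = expectedEdges A (permute π G)} {T = toℚ (triCount G)} (ℚ.<⇒≤ 0<p) (toℚ-nonNeg (edgeCount G))
                    (weighted-nonNeg (nonneg A) (λ S → toℚ-nonNeg (sampledEdges (permute π G) S)))
                    (proj₂ average) (κ-boundℚ (triCount G) 1≤T)
      where
      average : ∃[ π ] toℚ (edgeCount G) * p ≤ toℚ (κ (triCount G)) * expectedEdges A (permute π G)
      average = averaging G A (κ (triCount G)) (hits-load-linear G) p≤prob
      π : Permutation′ (3 ℕ.+ a)
      π = proj₁ average

    cubic-bound : ∀ {n} (G : Graph n) (A : Sampler n) →
                  (∀ π → p ≤ probTriangle A (permute π G)) → Cubic-bound (p * r) G A
    cubic-bound G A p≤prob = by-triangles (triCount G ℕ.≟ 0)
      where
      by-triangles : Dec (triCount G ≡ 0) → Cubic-bound (p * r) G A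
      by-triangles (yes T≡0) = ⊥-elim (ℚ.<-irrefl refl (ℚ.<-≤-trans 0<p (ℚ.≤-trans (p≤prob Perm.id)
                                                                          (triangle-free-unsampled G A T≡0))))
      by-triangles (no T≢0)  = cubic-bound-with-triangles G A p≤prob (ℕ.n≢0⇒n>0 T≢0)

open Sampling using (r; scaled-pos; cubic-bound)
open import Data.Product using (∃-syntax)
open import Data.Rational using (ℚ; 0ℚ; _≤_; _<_; _*_)

mainTheorem10 : (p : ℚ) → 0ℚ < p →
    ∃[ c ] (0ℚ < c × ((n : ℕ) (G : Graph n) (A : Sampler n) →
    ((π : Permutation′ n) → p ≤ probTriangle A (permute π G)) →
    ∃[ π ] ((c * toℚ (edgeCount G)) * (c * toℚ (edgeCount G)) * (c * toℚ (edgeCount G))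
    ≤ (expectedEdges A (permute π G) * expectedEdges A (permute π G) * expectedEdges A (permute π G))
    * (toℚ (triCount G) * toℚ (triCount G)))))
mainTheorem10 p 0<p = p * r , scaled-pos 0<p , λ n G A → cubic-bound 0<p G A
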